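{- Let $k\geq1$ and let $\mathrm{PM}_k^+$ be the span of the $\mathbf F_M$ with $M\neq\emptyset$. For all nonempty $k$-packed $M_1,M_2$ one has $\mathbf F_{M_1}\cdot\mathbf F_{M_2}=\mathbf F_{M_1}\prec\mathbf F_{M_2}+\mathbf F_{M_1}\succ\mathbf F_{M_2}$, and for all $x,y,z\in\mathrm{PM}_k^+$: \[(x\prec y)\prec z=x\prec(y\cdot z),\quad (x\succ y)\prec z=x\succ(y\prec z),\quad (x\cdot y)\succ z=x\succ(y\succ z).\] That is, $(\mathrm{PM}_k^+,\prec,\succ)$ is a dendriform algebra whose associated product is that of $\mathrm{PM}_k$.
   Context: Let $A_k=\{0,1,\dots,k\}$. A $k$-packed matrix of size $n\geq0$ is an $n\times n$ matrix with entries in $A_k$ such that every row and every column contains a nonzero entry. $\mathrm{PM}_k$ is the vector space over a field of characteristic zero with basis $\{\mathbf F_M\}$ indexed by $k$-packed matrices. Let $Z_a^b$ be the $a\times b$ zero matrix. For $M_1,M_2$ of sizes $n_1,n_2$ let $M_1\circ n_2=\begin{bmatrix}M_1\\ Z_{n_2}^{n_1}\end{bmatrix}$ and $n_1\circ M_2=\begin{bmatrix}Z_{n_1}^{n_2}\\ M_2\end{bmatrix}$; the column shifted shuffle $M_1\sqcup\!\sqcup M_2$ is the set of matrices whose sequence of columns is a shuffle of the columns of $M_1\circ n_2$ with those of $n_1\circ M_2$; product $\mathbf F_{M_1}\cdot\mathbf F_{M_2}=\sum_{M\in M_1\sqcup\!\sqcup M_2}\mathbf F_M$. For a nonempty matrix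 $N$ let $\mathrm{last_c}(N)$ be its last column. For nonempty $k$-packed $M_1,M_2$ define (and extend bilinearly to $\mathrm{PM}_k^+$) $\mathbf F_{M_1}\prec\mathbf F_{M_2}=\sum\mathbf F_M$ over $M\in M_1\sqcup\!\sqcup M_2$ with $\mathrm{last_c}(M)=\mathrm{last_c}(M_1\circ n_2)$, and $\mathbf F_{M_1}\succ\mathbf F_{M_2}=\sum\mathbf F_M$ over $M\in M_1\sqcup\!\sqcup M_2$ with $\mathrm{last_c}(M)=\mathrm{last_c}(n_1\circ M_2)$. -}

module Defs where

open import Level using (Level; _⊔_)
open import Data.Nat using (ℕ; zero; suc; _+_; _≟_; NonZero)
open import Data.Bool using (Bool; true; false; if_then_else_)
open import Data.Nat.Properties using (+-identityʳ; +-suc)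
open import Data.Fin using (Fin)
import Data.Fin as Fin
import Data.Fin.Properties as FinP
open import Data.Vec using (Vec; []; _∷_; _++_; replicate; last)
import Data.Vec as Vec
open import Data.Vec.Properties using (≡-dec)
open import Data.List using (List; []; _∷_; [_]; map; filter; concatMap; foldr)
import Data.List as List
open import Data.List.Relation.Unary.All using (All)
open import Data.Product using (Σ; _×_; _,_; proj₁; proj₂; ∃)
open import Relation.Nullary using (¬_; Dec; yes; no; does)
open import Relation.Binary.PropositionalEquality using (_≡_; refl; sym; subst)
open import Algebra.Bundles using (CommutativeRing)

module _ {c ℓ : Level} (R : CommutativeRing c ℓ) where
  open CommutativeRing R renaming (_+_ to _+R_)

  ℕ→R : ℕ → Carrier
  ℕ→R zero = 0#
  ℕ→R (suc n) = 1# +R ℕ→R n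

  record IsFieldOfCharZero : Set (c ⊔ ℓ) where
    field
      nontrivial : ¬ (1# ≈ 0#)
      inverse    : ∀ x → ¬ (x ≈ 0#) → ∃ λ y → (x * y) ≈ 1#
      charZero   : ∀ n → ¬ (ℕ→R (suc n) ≈ 0#)

-- Matrices with entries in A_k = {0,…,k} = Fin (suc k).
-- An n×n matrix is stored as its vector of n columns, each a vector
-- of n entries (top to bottom).

Entry : ℕ → Set
Entry k = Fin (suc k)

Column : ℕ → ℕ → Set
Column k n = Vec (Entry k) n

Matrix : ℕ → ℕ → Set
Matrix k n = Vec (Column k n) n

NonzeroEntry : ∀ {k} → Entry k → Set
NonzeroEntry e = ¬ (e ≡ Fin.zero)

HasNonzero : ∀ {k n} → Column k n → Set
HasNonzero {n = n} v = Σ (Fin n) λ i → NonzeroEntry (Vec.lookup v i)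

row : ∀ {k n} → Matrix k n → Fin n → Vec (Entry k) n
row M i = Vec.map (λ col → Vec.lookup col i) M

IsPacked : ∀ {k n} → Matrix k n → Set
IsPacked {n = n} M =
  ((j : Fin n) → HasNonzero (Vec.lookup M j)) ×
  ((i : Fin n) → HasNonzero (row M i))

shuffles : ∀ {A : Set} {m n} → Vec A m → Vec A n → List (Vec A (m + n))
shuffles [] ys = [ ys ]
shuffles {A} {suc m} {zero} (x ∷ xs) [] =
  [ subst (Vec A) (sym (+-identityʳ (suc m))) (x ∷ xs) ]
shuffles {A} {suc m} {suc n} (x ∷ xs) (y ∷ ys) =
  List._++_ (map (x ∷_) (shuffles xs (y ∷ ys)))
            (map (λ v → subst (Vec A) (sym (+-suc (suc m) n)) (y ∷ v))
                 (shuffles (x ∷ xs) ys))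

_∘ᵣ_ : ∀ {k n₁} → Matrix k n₁ → (n₂ : ℕ) → Vec (Column k (n₁ + n₂)) n₁
M₁ ∘ᵣ n₂ = Vec.map (λ col → col ++ replicate n₂ Fin.zero) M₁

_∘ₗ_ : ∀ {k n₂} → (n₁ : ℕ) → Matrix k n₂ → Vec (Column k (n₁ + n₂)) n₂
n₁ ∘ₗ M₂ = Vec.map (λ col → replicate n₁ Fin.zero ++ col) M₂

colShuffle : ∀ {k n₁ n₂} → Matrix k n₁ → Matrix k n₂ → List (Matrix k (n₁ + n₂))
colShuffle {n₁ = n₁} {n₂} M₁ M₂ = shuffles (M₁ ∘ᵣ n₂) (n₁ ∘ₗ M₂)

colEq? : ∀ {k n} (u v : Column k n) → Dec (u ≡ v)
colEq? = ≡-dec FinP._≟_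

precTerms : ∀ {k n₁ n₂} → Matrix k (suc n₁) → Matrix k (suc n₂)
          → List (Matrix k (suc n₁ + suc n₂))
precTerms {n₂ = n₂} M₁ M₂ =
  filter (λ M → colEq? (last M) (last (M₁ ∘ᵣ suc n₂))) (colShuffle M₁ M₂)

succTerms : ∀ {k n₁ n₂} → Matrix k (suc n₁) → Matrix k (suc n₂)
          → List (Matrix k (suc n₁ + suc n₂))
succTerms {n₁ = n₁} M₁ M₂ =
  filter (λ M → colEq? (last M) (last (suc n₁ ∘ₗ M₂))) (colShuffle M₁ M₂)

-- The vector space PM_k over R: finite formal linear combinations
-- Σ c_i F_{M_i}, represented as lists of (coefficient, size, matrix),
-- identified when all coefficients agree.

module Space {c ℓ : Level} (R : CommutativeRing c ℓ) (k : ℕ) where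
  open CommutativeRing R using (Carrier; _≈_; 0#; 1#) renaming (_+_ to _+R_; _*_ to _*R_)

  Label : Set
  Label = Σ ℕ (Matrix k)

  Term : Set c
  Term = Carrier × Label

  PM : Set c
  PM = List Term

  F : ∀ {n} → Matrix k n → PM
  F {n} M = [ (1# , (n , M)) ]

  sameLabel : Label → Label → Bool
  sameLabel (n , M) (n' , M') with n ≟ n'
  ... | yes refl = does (≡-dec colEq? M M')
  ... | no _ = false

  coeff : PM → (n : ℕ) → Matrix k n → Carrier
  coeff x n M = foldr (λ t s → if sameLabel (proj₂ t) (n , M) then proj₁ t +R s else s) 0# x

  _≋_ : PM → PM → Set ℓ
  x ≋ y = ∀ n (M : Matrix k n) → coeff x n M ≈ coeff y n M

  infix 4 _≋_

  InPM⁺ : PM → Set c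
  InPM⁺ x = All (λ t → NonZero (proj₁ (proj₂ t)) × IsPacked (proj₂ (proj₂ t))) x

  _⊕_ : PM → PM → PM
  x ⊕ y = x List.++ y

  bilinear : (∀ {n₁ n₂} → Matrix k n₁ → Matrix k n₂ → List Label) → PM → PM → PM
  bilinear op x y =
    concatMap (λ t → concatMap (λ u →
      map (λ l → (proj₁ t *R proj₁ u , l)) (op (proj₂ (proj₂ t)) (proj₂ (proj₂ u)))) y) x

  shuffleLabels : ∀ {n₁ n₂} → Matrix k n₁ → Matrix k n₂ → List Label
  shuffleLabels {n₁} {n₂} M₁ M₂ = map (λ M → (n₁ + n₂ , M)) (colShuffle M₁ M₂)

  -- ≺ and ≻ on basis elements (only meaningful for nonempty M₁, M₂,
  -- which is the only case used on PM_k^+)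
  precLabels : ∀ {n₁ n₂} → Matrix k n₁ → Matrix k n₂ → List Label
  precLabels {suc n₁} {suc n₂} M₁ M₂ = map (λ M → (suc n₁ + suc n₂ , M)) (precTerms M₁ M₂)
  precLabels _ _ = []

  succLabels : ∀ {n₁ n₂} → Matrix k n₁ → Matrix k n₂ → List Label
  succLabels {suc n₁} {suc n₂} M₁ M₂ = map (λ M → (suc n₁ + suc n₂ , M)) (succTerms M₁ M₂)
  succLabels _ _ = []

  _·_ : PM → PM → PM
  _·_ = bilinear shuffleLabels

  _≺_ : PM → PM → PM
  _≺_ = bilinear precLabels

  _≻_ : PM → PM → PM
  _≻_ = bilinear succLabels

  infixl 7 _·_ _≺_ _≻_
  infixl 6 _⊕_

-- Flatten every matrix to its list of columns. The column shifted shuffle is then the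
-- ordinary shuffle of the columns of M₁ padded below with those of M₂ padded above, and ≺
-- (resp. ≻) keeps the shuffles ending with the last padded column of M₁ (resp. M₂). A column
-- of a packed matrix is nonzero, so no column padded below equals a column padded above;
-- hence F_{M₁} ≺ F_{M₂} consists exactly of the shuffles of M₁ without its last column with
-- M₂, followed by that column, and dually for ≻. With this description the splitting of the
-- product and the three dendriform identities reduce to associativity of the shuffle of words
-- and to its decomposition according to the last letter. All these identities hold as
-- permutations of the lists of terms; coefficients only enter through associativity of the
-- product of scalars.
module Submission where

open import Defs

open import Level using (Level)
open import Algebra.Bundles using (CommutativeRing; CommutativeMonoid)
import Algebra.Properties.CommutativeSemigroup as CommutativeSemigroupProperties
open import Data.Bool using (Bool; true; false; if_then_else_)
open import Data.Empty using (⊥-elim)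
import Data.Fin as Fin
open import Data.List
  using (List; []; _∷_; [_]; _++_; _∷ʳ_; map; concat; concatMap; filter; foldr; last; replicate; initLast; _∷ʳ′_)
import Data.List.Properties as List
open import Data.List.Properties
  using ( map-++; map-∘; map-cong; ++-assoc; ++-identityʳ; ++-cancelˡ
        ; concatMap-cong; concatMap-++; concatMap-map; map-concatMap; concatMap-pure
        ; filter-all; filter-none; filter-++ )
open import Data.List.Relation.Unary.All using (All; []; _∷_; universal)
import Data.List.Relation.Unary.All as All
open import Data.List.Relation.Unary.All.Properties using (∷ʳ⁻; ++⁺) renaming (map⁺ to All-map⁺)
open import Data.List.Relation.Binary.Permutation.Propositional as ↭
  using (_↭_; ↭-refl; ↭-sym; ↭-trans; ↭-reflexive; ↭-prep; ↭-swap; module PermutationReasoning)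
open import Data.List.Relation.Binary.Permutation.Propositional.Properties
  using (map⁺; ++⁺ˡ; ++⁺ʳ; shifts; filter-↭; ++-commutativeMonoid) renaming (++⁺ to ↭-++⁺)
open import Data.Maybe using (Maybe; just)
import Data.Maybe as Maybe
open import Data.Maybe.Properties using (just-injective) renaming (≡-dec to ≡-dec-Maybe)
open import Data.Nat using (ℕ; zero; suc; _+_; _≤_; NonZero)
import Data.Nat as Nat
open import Data.Nat.Properties using (+-assoc)
open import Data.Product using (_×_; _,_; proj₁; proj₂; map₂)
open import Data.Vec using (Vec; []; _∷_; toList)
import Data.Vec as Vec
import Data.Vec.Properties as Vec
open import Data.Vec.Relation.Binary.Equality.Cast using (cast-is-id)
open import Function using (_∘_)
open import Function.Bundles using (_⇔_; mk⇔)
open import Relation.Binary.Bundles using (Setoid)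
open import Relation.Binary.Definitions using (DecidableEquality)
open import Relation.Binary.PropositionalEquality
  using (_≡_; _≢_; refl; sym; trans; cong; cong₂; subst; ≢-sym; module ≡-Reasoning)
import Relation.Binary.Reasoning.Setoid as SetoidReasoning
open import Relation.Nullary using (does; yes; no)
open import Relation.Nullary.Decidable using (does-⇔)
open import Relation.Unary using (Pred; Decidable)

private
  variable
    a b c d : Level
    A : Set a
    B : Set b
    C : Set c
    D : Set d

map-comm : {f : B → C} {g : A → B} {f′ : D → C} {g′ : A → D} →
           (∀ x → f (g x) ≡ f′ (g′ x)) → ∀ xs → map f (map g xs) ≡ map f′ (map g′ xs)
map-comm eq xs = trans (sym (map-∘ xs)) (trans (map-cong eq xs) (map-∘ xs))

map-fuse : {f : B → C} {g : A → B} {h : A → C} → (∀ x → f (g x) ≡ h x) → ∀ xs → map f (map g xs) ≡ map h xs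
map-fuse eq xs = trans (sym (map-∘ xs)) (map-cong eq xs)

concatMap-concatMap : (f : B → List C) (g : A → List B) (xs : List A) →
                      concatMap f (concatMap g xs) ≡ concatMap (concatMap f ∘ g) xs
concatMap-concatMap f g []       = refl
concatMap-concatMap f g (x ∷ xs) =
  trans (concatMap-++ f (g x) _) (cong (concatMap f (g x) ++_) (concatMap-concatMap f g xs))

++-interchange : (ws xs ys zs : List A) → (ws ++ xs) ++ (ys ++ zs) ↭ (ws ++ ys) ++ (xs ++ zs)
++-interchange {A = A} = interchange
  where open CommutativeSemigroupProperties
               (CommutativeMonoid.commutativeSemigroup (++-commutativeMonoid {A = A}))

map-filter : ∀ {p q} {P : Pred A p} {Q : Pred B q} (P? : Decidable P) (Q? : Decidable Q) (f : A → B) →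
             (∀ x → P x ⇔ Q (f x)) → ∀ xs → map f (filter P? xs) ≡ filter Q? (map f xs)
map-filter P? Q? f equiv []       = refl
map-filter P? Q? f equiv (x ∷ xs) with does (P? x) | does (Q? (f x)) | does-⇔ (equiv x) (P? x) (Q? (f x))
... | true  | true  | refl = cong (f x ∷_) (map-filter P? Q? f equiv xs)
... | false | false | refl = map-filter P? Q? f equiv xs

concat⁺ : {xss yss : List (List A)} → xss ↭ yss → concat xss ↭ concat yss
concat⁺ ↭.refl           = ↭-refl
concat⁺ (↭.prep xs p)    = ++⁺ˡ xs (concat⁺ p)
concat⁺ (↭.swap xs ys p) = ↭-trans (shifts xs ys) (++⁺ˡ ys (++⁺ˡ xs (concat⁺ p)))
concat⁺ (↭.trans p q)    = ↭-trans (concat⁺ p) (concat⁺ q)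

concatMap⁺ : (f : A → List B) {xs ys : List A} → xs ↭ ys → concatMap f xs ↭ concatMap f ys
concatMap⁺ f p = concat⁺ (map⁺ f p)

concatMap-cong-↭ : {f g : A → List B} {xs : List A} →
                   All (λ x → f x ↭ g x) xs → concatMap f xs ↭ concatMap g xs
concatMap-cong-↭ []       = ↭-refl
concatMap-cong-↭ (p ∷ ps) = ↭-++⁺ p (concatMap-cong-↭ ps)

concatMap-↭-map : (f : A → List C) (g : A → List B) {h : B → C} {xs : List A} →
                  All (λ x → f x ↭ map h (g x)) xs → concatMap f xs ↭ map h (concatMap g xs)
concatMap-↭-map f g {h} {xs} ps =
  ↭-trans (concatMap-cong-↭ ps) (↭-reflexive (sym (map-concatMap h g xs)))

concatMap-++-↭ : (f g : A → List B) (xs : List A) →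
                 concatMap (λ x → f x ++ g x) xs ↭ concatMap f xs ++ concatMap g xs
concatMap-++-↭ f g []       = ↭-refl
concatMap-++-↭ f g (x ∷ xs) =
  ↭-trans (++⁺ˡ (f x ++ g x) (concatMap-++-↭ f g xs)) (++-interchange (f x) (g x) _ _)

concatMap-comm : (h : A → B → List C) (xs : List A) (ys : List B) →
                 concatMap (λ x → concatMap (h x) ys) xs ↭ concatMap (λ y → concatMap (λ x → h x y) xs) ys
concatMap-comm h []       ys = ↭-reflexive (sym (concatMap-[] ys))
  where
  concatMap-[] : (ys : List B) → concatMap {B = C} (λ _ → []) ys ≡ []
  concatMap-[] []       = refl
  concatMap-[] (_ ∷ ys) = concatMap-[] ys
concatMap-comm h (x ∷ xs) ys =
  ↭-trans (++⁺ˡ (concatMap (h x) ys) (concatMap-comm h xs ys))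
          (↭-sym (concatMap-++-↭ (h x) (λ y → concatMap (λ x → h x y) xs) ys))

-- Shuffles of lists

infix 6 _⧢_

_⧢_ : List A → List A → List (List A)
[]       ⧢ ys       = [ ys ]
(x ∷ xs) ⧢ []       = [ x ∷ xs ]
(x ∷ xs) ⧢ (y ∷ ys) = map (x ∷_) (xs ⧢ (y ∷ ys)) ++ map (y ∷_) ((x ∷ xs) ⧢ ys)

⧢-[] : (xs : List A) → xs ⧢ [] ≡ [ xs ]
⧢-[] []      = refl
⧢-[] (_ ∷ _) = refl

map-⧢ : (f : A → B) (xs ys : List A) → map (map f) (xs ⧢ ys) ≡ map f xs ⧢ map f ys
map-⧢ f []       ys       = refl
map-⧢ f (x ∷ xs) []       = refl
map-⧢ f (x ∷ xs) (y ∷ ys) = begin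
  map (map f) (map (x ∷_) (xs ⧢ (y ∷ ys)) ++ map (y ∷_) ((x ∷ xs) ⧢ ys))
    ≡⟨ map-++ (map f) (map (x ∷_) (xs ⧢ (y ∷ ys))) (map (y ∷_) ((x ∷ xs) ⧢ ys)) ⟩
  map (map f) (map (x ∷_) (xs ⧢ (y ∷ ys))) ++ map (map f) (map (y ∷_) ((x ∷ xs) ⧢ ys))
    ≡⟨ cong₂ _++_ (map-comm (λ _ → refl) (xs ⧢ (y ∷ ys))) (map-comm (λ _ → refl) ((x ∷ xs) ⧢ ys)) ⟩
  map (f x ∷_) (map (map f) (xs ⧢ (y ∷ ys))) ++ map (f y ∷_) (map (map f) ((x ∷ xs) ⧢ ys))
    ≡⟨ cong₂ (λ l r → map (f x ∷_) l ++ map (f y ∷_) r) (map-⧢ f xs (y ∷ ys)) (map-⧢ f (x ∷ xs) ys) ⟩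
  map f (x ∷ xs) ⧢ map f (y ∷ ys) ∎
  where open ≡-Reasoning

⧢-All : ∀ {p} {P : A → Set p} {xs ys : List A} → All P xs → All P ys → All (All P) (xs ⧢ ys)
⧢-All []         pys        = pys ∷ []
⧢-All (px ∷ pxs) []         = (px ∷ pxs) ∷ []
⧢-All (px ∷ pxs) (py ∷ pys) =
  ++⁺ (All-map⁺ (All.map (px ∷_) (⧢-All pxs (py ∷ pys)))) (All-map⁺ (All.map (py ∷_) (⧢-All (px ∷ pxs) pys)))

concatMap-∷⧢∷ : (h : List A → List B) (x y : A) (xs ys : List A) →
                concatMap h ((x ∷ xs) ⧢ (y ∷ ys)) ≡
                concatMap (h ∘ (x ∷_)) (xs ⧢ (y ∷ ys)) ++ concatMap (h ∘ (y ∷_)) ((x ∷ xs) ⧢ ys)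
concatMap-∷⧢∷ h x y xs ys =
  trans (concatMap-++ h (map (x ∷_) (xs ⧢ (y ∷ ys))) (map (y ∷_) ((x ∷ xs) ⧢ ys)))
        (cong₂ _++_ (concatMap-map h (x ∷_) (xs ⧢ (y ∷ ys))) (concatMap-map h (y ∷_) ((x ∷ xs) ⧢ ys)))

-- Both bracketings of a triple shuffle satisfy the same recursion on the first letter.
module _ (x y z : A) (xs ys zs : List A) where
  private
    X = x ∷ xs
    Y = y ∷ ys
    Z = z ∷ zs

  ⧢-assocˡ-∷ : concatMap (_⧢ Z) (X ⧢ Y) ↭
    (map (x ∷_) (concatMap (_⧢ Z) (xs ⧢ Y)) ++ map (y ∷_) (concatMap (_⧢ Z) (X ⧢ ys)))
      ++ map (z ∷_) (concatMap (_⧢ zs) (X ⧢ Y))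
  ⧢-assocˡ-∷ = begin
    concatMap (_⧢ Z) (X ⧢ Y)
      ≡⟨ concatMap-∷⧢∷ (_⧢ Z) x y xs ys ⟩
    concatMap (λ w → map (x ∷_) (w ⧢ Z) ++ map (z ∷_) ((x ∷ w) ⧢ zs)) (xs ⧢ Y) ++
    concatMap (λ w → map (y ∷_) (w ⧢ Z) ++ map (z ∷_) ((y ∷ w) ⧢ zs)) (X ⧢ ys)
      ↭⟨ ↭-++⁺ (concatMap-++-↭ _ _ (xs ⧢ Y)) (concatMap-++-↭ _ _ (X ⧢ ys)) ⟩
    (Px ++ Pz) ++ (Qy ++ Qz)
      ↭⟨ ++-interchange Px Pz Qy Qz ⟩
    (Px ++ Qy) ++ (Pz ++ Qz)
      ≡⟨ cong₂ (λ l r → (l ++ r) ++ (Pz ++ Qz))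
           (sym (map-concatMap (x ∷_) (_⧢ Z) (xs ⧢ Y))) (sym (map-concatMap (y ∷_) (_⧢ Z) (X ⧢ ys))) ⟩
    (map (x ∷_) (concatMap (_⧢ Z) (xs ⧢ Y)) ++ map (y ∷_) (concatMap (_⧢ Z) (X ⧢ ys))) ++ (Pz ++ Qz)
      ≡⟨ cong ((map (x ∷_) (concatMap (_⧢ Z) (xs ⧢ Y)) ++ map (y ∷_) (concatMap (_⧢ Z) (X ⧢ ys))) ++_) last-letter-z ⟩
    (map (x ∷_) (concatMap (_⧢ Z) (xs ⧢ Y)) ++ map (y ∷_) (concatMap (_⧢ Z) (X ⧢ ys)))
      ++ map (z ∷_) (concatMap (_⧢ zs) (X ⧢ Y)) ∎
    where
    open PermutationReasoning
    Px = concatMap (map (x ∷_) ∘ (_⧢ Z)) (xs ⧢ Y)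
    Pz = concatMap (λ w → map (z ∷_) ((x ∷ w) ⧢ zs)) (xs ⧢ Y)
    Qy = concatMap (map (y ∷_) ∘ (_⧢ Z)) (X ⧢ ys)
    Qz = concatMap (λ w → map (z ∷_) ((y ∷ w) ⧢ zs)) (X ⧢ ys)
    last-letter-z : Pz ++ Qz ≡ map (z ∷_) (concatMap (_⧢ zs) (X ⧢ Y))
    last-letter-z =
      trans (cong₂ _++_ (sym (map-concatMap (z ∷_) ((_⧢ zs) ∘ (x ∷_)) (xs ⧢ Y)))
                        (sym (map-concatMap (z ∷_) ((_⧢ zs) ∘ (y ∷_)) (X ⧢ ys))))
            (trans (sym (map-++ (z ∷_) (concatMap ((_⧢ zs) ∘ (x ∷_)) (xs ⧢ Y)) (concatMap ((_⧢ zs) ∘ (y ∷_)) (X ⧢ ys))))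
                   (cong (map (z ∷_)) (sym (concatMap-∷⧢∷ (_⧢ zs) x y xs ys))))

  ⧢-assocʳ-∷ : concatMap (X ⧢_) (Y ⧢ Z) ↭
    (map (x ∷_) (concatMap (xs ⧢_) (Y ⧢ Z)) ++ map (y ∷_) (concatMap (X ⧢_) (ys ⧢ Z)))
      ++ map (z ∷_) (concatMap (X ⧢_) (Y ⧢ zs))
  ⧢-assocʳ-∷ = begin
    concatMap (X ⧢_) (Y ⧢ Z)
      ≡⟨ concatMap-∷⧢∷ (X ⧢_) y z ys zs ⟩
    concatMap (λ w → map (x ∷_) (xs ⧢ (y ∷ w)) ++ map (y ∷_) (X ⧢ w)) (ys ⧢ Z) ++
    concatMap (λ w → map (x ∷_) (xs ⧢ (z ∷ w)) ++ map (z ∷_) (X ⧢ w)) (Y ⧢ zs)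
      ↭⟨ ↭-++⁺ (concatMap-++-↭ _ _ (ys ⧢ Z)) (concatMap-++-↭ _ _ (Y ⧢ zs)) ⟩
    (Py ++ Ry) ++ (Pz ++ Rz)
      ↭⟨ ++-interchange Py Ry Pz Rz ⟩
    (Py ++ Pz) ++ (Ry ++ Rz)
      ≡⟨ cong₂ _++_ first-letter-x
           (cong₂ _++_ (sym (map-concatMap (y ∷_) (X ⧢_) (ys ⧢ Z))) (sym (map-concatMap (z ∷_) (X ⧢_) (Y ⧢ zs)))) ⟩
    map (x ∷_) (concatMap (xs ⧢_) (Y ⧢ Z)) ++
      (map (y ∷_) (concatMap (X ⧢_) (ys ⧢ Z)) ++ map (z ∷_) (concatMap (X ⧢_) (Y ⧢ zs)))
      ≡⟨ ++-assoc (map (x ∷_) (concatMap (xs ⧢_) (Y ⧢ Z))) _ _ ⟨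
    (map (x ∷_) (concatMap (xs ⧢_) (Y ⧢ Z)) ++ map (y ∷_) (concatMap (X ⧢_) (ys ⧢ Z)))
      ++ map (z ∷_) (concatMap (X ⧢_) (Y ⧢ zs)) ∎
    where
    open PermutationReasoning
    Py = concatMap (λ w → map (x ∷_) (xs ⧢ (y ∷ w))) (ys ⧢ Z)
    Ry = concatMap (map (y ∷_) ∘ (X ⧢_)) (ys ⧢ Z)
    Pz = concatMap (λ w → map (x ∷_) (xs ⧢ (z ∷ w))) (Y ⧢ zs)
    Rz = concatMap (map (z ∷_) ∘ (X ⧢_)) (Y ⧢ zs)
    first-letter-x : Py ++ Pz ≡ map (x ∷_) (concatMap (xs ⧢_) (Y ⧢ Z))
    first-letter-x =
      trans (cong₂ _++_ (sym (map-concatMap (x ∷_) ((xs ⧢_) ∘ (y ∷_)) (ys ⧢ Z)))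
                        (sym (map-concatMap (x ∷_) ((xs ⧢_) ∘ (z ∷_)) (Y ⧢ zs))))
            (trans (sym (map-++ (x ∷_) (concatMap ((xs ⧢_) ∘ (y ∷_)) (ys ⧢ Z)) (concatMap ((xs ⧢_) ∘ (z ∷_)) (Y ⧢ zs))))
                   (cong (map (x ∷_)) (sym (concatMap-∷⧢∷ (xs ⧢_) y z ys zs))))

⧢-assoc : (xs ys zs : List A) → concatMap (_⧢ zs) (xs ⧢ ys) ↭ concatMap (xs ⧢_) (ys ⧢ zs)
⧢-assoc []       ys       zs       = ↭-reflexive (trans (++-identityʳ (ys ⧢ zs)) (sym (concatMap-pure (ys ⧢ zs))))
⧢-assoc (x ∷ xs) []       zs       = ↭-refl
⧢-assoc (x ∷ xs) (y ∷ ys) []       = ↭-reflexive (begin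
  concatMap (_⧢ []) W ≡⟨ concatMap-cong ⧢-[] W ⟩
  concatMap [_] W     ≡⟨ concatMap-pure W ⟩
  W                   ≡⟨ ++-identityʳ W ⟨
  W ++ []             ∎)
  where
  open ≡-Reasoning
  W = (x ∷ xs) ⧢ (y ∷ ys)
⧢-assoc (x ∷ xs) (y ∷ ys) (z ∷ zs) =
  ↭-trans (⧢-assocˡ-∷ x y z xs ys zs)
    (↭-trans (↭-++⁺ (↭-++⁺ (map⁺ (x ∷_) (⧢-assoc xs (y ∷ ys) (z ∷ zs)))
                            (map⁺ (y ∷_) (⧢-assoc (x ∷ xs) ys (z ∷ zs))))
                    (map⁺ (z ∷_) (⧢-assoc (x ∷ xs) (y ∷ ys) zs)))
             (↭-sym (⧢-assocʳ-∷ x y z xs ys zs)))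

∷ʳ-⧢-∷ʳ : (xs : List A) (x : A) (ys : List A) (y : A) →
          (xs ∷ʳ x) ⧢ (ys ∷ʳ y) ↭ map (_∷ʳ x) (xs ⧢ (ys ∷ʳ y)) ++ map (_∷ʳ y) ((xs ∷ʳ x) ⧢ ys)
∷ʳ-⧢-∷ʳ []       x []       y = ↭-swap _ _ ↭-refl
∷ʳ-⧢-∷ʳ []       x (c ∷ bs) y =
  ↭-trans (↭-prep _ (map⁺ (c ∷_) (∷ʳ-⧢-∷ʳ [] x bs y)))
          (↭-swap _ _ (↭-reflexive (map-comm (λ _ → refl) ([ x ] ⧢ bs))))
∷ʳ-⧢-∷ʳ (a ∷ as) x []       y = begin
  map (a ∷_) ((as ∷ʳ x) ⧢ [ y ]) ++ [ v ]
    ↭⟨ ++⁺ʳ [ v ] (map⁺ (a ∷_) (∷ʳ-⧢-∷ʳ as x [] y)) ⟩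
  map (a ∷_) (map (_∷ʳ x) (as ⧢ [ y ]) ++ map (_∷ʳ y) ((as ∷ʳ x) ⧢ [])) ++ [ v ]
    ≡⟨ cong (λ t → map (a ∷_) (map (_∷ʳ x) (as ⧢ [ y ]) ++ map (_∷ʳ y) t) ++ [ v ]) (⧢-[] (as ∷ʳ x)) ⟩
  map (a ∷_) (map (_∷ʳ x) (as ⧢ [ y ]) ++ [ as ∷ʳ x ∷ʳ y ]) ++ [ v ]
    ≡⟨ cong (_++ [ v ]) (map-++ (a ∷_) (map (_∷ʳ x) (as ⧢ [ y ])) [ as ∷ʳ x ∷ʳ y ]) ⟩
  (map (a ∷_) (map (_∷ʳ x) (as ⧢ [ y ])) ++ [ u ]) ++ [ v ]
    ≡⟨ ++-assoc (map (a ∷_) (map (_∷ʳ x) (as ⧢ [ y ]))) [ u ] [ v ] ⟩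
  map (a ∷_) (map (_∷ʳ x) (as ⧢ [ y ])) ++ u ∷ v ∷ []
    ↭⟨ ++⁺ˡ (map (a ∷_) (map (_∷ʳ x) (as ⧢ [ y ]))) (↭-swap u v ↭-refl) ⟩
  map (a ∷_) (map (_∷ʳ x) (as ⧢ [ y ])) ++ v ∷ u ∷ []
    ≡⟨ cong (_++ v ∷ u ∷ []) (map-comm (λ _ → refl) (as ⧢ [ y ])) ⟩
  map (_∷ʳ x) (map (a ∷_) (as ⧢ [ y ])) ++ v ∷ u ∷ []
    ≡⟨ ++-assoc (map (_∷ʳ x) (map (a ∷_) (as ⧢ [ y ]))) [ v ] [ u ] ⟨
  (map (_∷ʳ x) (map (a ∷_) (as ⧢ [ y ])) ++ [ v ]) ++ [ u ]
    ≡⟨ cong (_++ [ u ]) (map-++ (_∷ʳ x) (map (a ∷_) (as ⧢ [ y ])) [ y ∷ a ∷ as ]) ⟨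
  map (_∷ʳ x) ((a ∷ as) ⧢ [ y ]) ++ map (_∷ʳ y) ((a ∷ as ∷ʳ x) ⧢ []) ∎
  where
  open PermutationReasoning
  u = a ∷ as ∷ʳ x ∷ʳ y
  v = y ∷ a ∷ as ∷ʳ x
∷ʳ-⧢-∷ʳ {A = A} (a ∷ as) x (c ∷ bs) y = begin
  map (a ∷_) ((as ∷ʳ x) ⧢ (c ∷ bs ∷ʳ y)) ++ map (c ∷_) ((a ∷ as ∷ʳ x) ⧢ (bs ∷ʳ y))
    ↭⟨ ↭-++⁺ (map⁺ (a ∷_) (∷ʳ-⧢-∷ʳ as x (c ∷ bs) y)) (map⁺ (c ∷_) (∷ʳ-⧢-∷ʳ (a ∷ as) x bs y)) ⟩
  map (a ∷_) (map (_∷ʳ x) P ++ map (_∷ʳ y) Q) ++ map (c ∷_) (map (_∷ʳ x) P′ ++ map (_∷ʳ y) Q′)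
    ≡⟨ cong₂ _++_ (push a P Q) (push c P′ Q′) ⟩
  (map (_∷ʳ x) (map (a ∷_) P) ++ map (_∷ʳ y) (map (a ∷_) Q)) ++
  (map (_∷ʳ x) (map (c ∷_) P′) ++ map (_∷ʳ y) (map (c ∷_) Q′))
    ↭⟨ ++-interchange (map (_∷ʳ x) (map (a ∷_) P)) _ _ _ ⟩
  (map (_∷ʳ x) (map (a ∷_) P) ++ map (_∷ʳ x) (map (c ∷_) P′)) ++
  (map (_∷ʳ y) (map (a ∷_) Q) ++ map (_∷ʳ y) (map (c ∷_) Q′))
    ≡⟨ cong₂ _++_ (map-++ (_∷ʳ x) (map (a ∷_) P) (map (c ∷_) P′))
                  (map-++ (_∷ʳ y) (map (a ∷_) Q) (map (c ∷_) Q′)) ⟨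
  map (_∷ʳ x) ((a ∷ as) ⧢ (c ∷ bs ∷ʳ y)) ++ map (_∷ʳ y) ((a ∷ as ∷ʳ x) ⧢ (c ∷ bs)) ∎
  where
  open PermutationReasoning
  P  = as ⧢ (c ∷ bs ∷ʳ y)
  Q  = (as ∷ʳ x) ⧢ (c ∷ bs)
  P′ = (a ∷ as) ⧢ (bs ∷ʳ y)
  Q′ = (a ∷ as ∷ʳ x) ⧢ bs
  push : ∀ e (L M : List (List A)) →
         map (e ∷_) (map (_∷ʳ x) L ++ map (_∷ʳ y) M) ≡ map (_∷ʳ x) (map (e ∷_) L) ++ map (_∷ʳ y) (map (e ∷_) M)
  push e L M = trans (map-++ (e ∷_) (map (_∷ʳ x) L) (map (_∷ʳ y) M))
                     (cong₂ _++_ (map-comm (λ _ → refl) L) (map-comm (λ _ → refl) M))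

-- Shuffles ending in a prescribed letter

last-∷ʳ : (xs : List A) (x : A) → last (xs ∷ʳ x) ≡ just x
last-∷ʳ []           x = refl
last-∷ʳ (_ ∷ [])     x = refl
last-∷ʳ (_ ∷ y ∷ xs) x = last-∷ʳ (y ∷ xs) x

module LastLetter {A : Set a} (_≟_ : DecidableEquality A) where

  lastIs? : (m : Maybe A) → Decidable (λ w → last w ≡ m)
  lastIs? m w = ≡-dec-Maybe _≟_ (last w) m

  filter-∷ʳ-accept : (x : A) (W : List (List A)) → filter (lastIs? (just x)) (map (_∷ʳ x) W) ≡ map (_∷ʳ x) W
  filter-∷ʳ-accept x W = filter-all (lastIs? (just x)) (All-map⁺ (universal (λ w → last-∷ʳ w x) W))

  filter-∷ʳ-reject : {x y : A} → y ≢ x → (W : List (List A)) → filter (lastIs? (just x)) (map (_∷ʳ y) W) ≡ []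
  filter-∷ʳ-reject {x} {y} y≢x W = filter-none (lastIs? (just x))
    (All-map⁺ (universal (λ w eq → y≢x (just-injective (trans (sym (last-∷ʳ w y)) eq))) W))

  filter-lastIs-∷ʳ⧢ : (xs : List A) (x : A) (ys : List A) → All (_≢ x) ys →
                      filter (lastIs? (just x)) ((xs ∷ʳ x) ⧢ ys) ↭ map (_∷ʳ x) (xs ⧢ ys)
  filter-lastIs-∷ʳ⧢ xs x ys ys≢x with initLast ys
  ... | [] = ↭-reflexive (begin
    filter (lastIs? (just x)) ((xs ∷ʳ x) ⧢ []) ≡⟨ cong (filter (lastIs? (just x))) (⧢-[] (xs ∷ʳ x)) ⟩
    filter (lastIs? (just x)) [ xs ∷ʳ x ]     ≡⟨ filter-∷ʳ-accept x [ xs ] ⟩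
    [ xs ∷ʳ x ]                               ≡⟨ cong (map (_∷ʳ x)) (⧢-[] xs) ⟨
    map (_∷ʳ x) (xs ⧢ [])                     ∎)
    where open ≡-Reasoning
  ... | ys′ ∷ʳ′ y = ↭-trans (filter-↭ (lastIs? (just x)) (∷ʳ-⧢-∷ʳ xs x ys′ y)) (↭-reflexive (begin
    filter (lastIs? (just x)) (map (_∷ʳ x) (xs ⧢ (ys′ ∷ʳ y)) ++ map (_∷ʳ y) ((xs ∷ʳ x) ⧢ ys′))
      ≡⟨ filter-++ (lastIs? (just x)) (map (_∷ʳ x) (xs ⧢ (ys′ ∷ʳ y))) (map (_∷ʳ y) ((xs ∷ʳ x) ⧢ ys′)) ⟩
    filter (lastIs? (just x)) (map (_∷ʳ x) (xs ⧢ (ys′ ∷ʳ y))) ++ filter (lastIs? (just x)) (map (_∷ʳ y) ((xs ∷ʳ x) ⧢ ys′))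
      ≡⟨ cong₂ _++_ (filter-∷ʳ-accept x (xs ⧢ (ys′ ∷ʳ y))) (filter-∷ʳ-reject (proj₂ (∷ʳ⁻ ys≢x)) ((xs ∷ʳ x) ⧢ ys′)) ⟩
    map (_∷ʳ x) (xs ⧢ (ys′ ∷ʳ y)) ++ []
      ≡⟨ ++-identityʳ (map (_∷ʳ x) (xs ⧢ (ys′ ∷ʳ y))) ⟩
    map (_∷ʳ x) (xs ⧢ (ys′ ∷ʳ y)) ∎))
    where open ≡-Reasoning

  filter-lastIs-⧢∷ʳ : (xs ys : List A) (y : A) → All (_≢ y) xs →
                      filter (lastIs? (just y)) (xs ⧢ (ys ∷ʳ y)) ↭ map (_∷ʳ y) (xs ⧢ ys)
  filter-lastIs-⧢∷ʳ xs ys y xs≢y with initLast xs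
  ... | [] = ↭-reflexive (filter-∷ʳ-accept y [ ys ])
  ... | xs′ ∷ʳ′ x = ↭-trans (filter-↭ (lastIs? (just y)) (∷ʳ-⧢-∷ʳ xs′ x ys y)) (↭-reflexive (begin
    filter (lastIs? (just y)) (map (_∷ʳ x) (xs′ ⧢ (ys ∷ʳ y)) ++ map (_∷ʳ y) ((xs′ ∷ʳ x) ⧢ ys))
      ≡⟨ filter-++ (lastIs? (just y)) (map (_∷ʳ x) (xs′ ⧢ (ys ∷ʳ y))) (map (_∷ʳ y) ((xs′ ∷ʳ x) ⧢ ys)) ⟩
    filter (lastIs? (just y)) (map (_∷ʳ x) (xs′ ⧢ (ys ∷ʳ y))) ++ filter (lastIs? (just y)) (map (_∷ʳ y) ((xs′ ∷ʳ x) ⧢ ys))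
      ≡⟨ cong₂ _++_ (filter-∷ʳ-reject (proj₂ (∷ʳ⁻ xs≢y)) (xs′ ⧢ (ys ∷ʳ y))) (filter-∷ʳ-accept y ((xs′ ∷ʳ x) ⧢ ys)) ⟩
    map (_∷ʳ y) ((xs′ ∷ʳ x) ⧢ ys) ∎))
    where open ≡-Reasoning

-- Matrices flattened to lists of columns, and their shifted shuffles

module Flat (k : ℕ) where

  Col : Set
  Col = List (Entry k)

  -- A matrix of size n given by its list of columns; n is kept separately
  -- since it is the amount of zero padding used by the shifted shuffles.
  FlatLabel : Set
  FlatLabel = ℕ × List Col

  _≟ᶜ_ : DecidableEquality Col
  _≟ᶜ_ = List.≡-dec Fin._≟_

  open LastLetter _≟ᶜ_ public

  zeros : ℕ → Col
  zeros n = replicate n Fin.zero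

  padBelow : ℕ → Col → Col
  padBelow m c = c ++ zeros m

  padAbove : ℕ → Col → Col
  padAbove n c = zeros n ++ c

  zeros-+ : ∀ m n → zeros (m + n) ≡ zeros m ++ zeros n
  zeros-+ zero    n = refl
  zeros-+ (suc m) n = cong (Fin.zero ∷_) (zeros-+ m n)

  padBelow-padBelow : ∀ n m c → padBelow m (padBelow n c) ≡ padBelow (n + m) c
  padBelow-padBelow n m c = trans (++-assoc c (zeros n) (zeros m)) (cong (c ++_) (sym (zeros-+ n m)))

  padBelow-padAbove : ∀ n m c → padBelow m (padAbove n c) ≡ padAbove n (padBelow m c)
  padBelow-padAbove n m c = ++-assoc (zeros n) c (zeros m)

  padAbove-padAbove : ∀ n m c → padAbove m (padAbove n c) ≡ padAbove (m + n) c
  padAbove-padAbove n m c = trans (sym (++-assoc (zeros m) (zeros n) c)) (cong (_++ c) (sym (zeros-+ m n)))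

  -- c has a nonzero entry among its first n rows; quantifying over the
  -- continuations r and s makes this independent of the length of c.
  NonzeroWithin : ℕ → Col → Set
  NonzeroWithin n c = ∀ r s → c ++ r ≢ zeros n ++ s

  padBelow-NonzeroWithin : ∀ {n c} m → NonzeroWithin n c → NonzeroWithin (n + m) (padBelow m c)
  padBelow-NonzeroWithin {n} {c} m nz r s eq = nz (zeros m ++ r) (zeros m ++ s) (begin
    c ++ zeros m ++ r         ≡⟨ ++-assoc c (zeros m) r ⟨
    padBelow m c ++ r         ≡⟨ eq ⟩
    zeros (n + m) ++ s        ≡⟨ cong (_++ s) (zeros-+ n m) ⟩
    (zeros n ++ zeros m) ++ s ≡⟨ ++-assoc (zeros n) (zeros m) s ⟩
    zeros n ++ zeros m ++ s   ∎)
    where open ≡-Reasoning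

  padAbove-NonzeroWithin : ∀ {m c} n → NonzeroWithin m c → NonzeroWithin (n + m) (padAbove n c)
  padAbove-NonzeroWithin {m} {c} n nz r s eq = nz r s (++-cancelˡ (zeros n) (c ++ r) (zeros m ++ s) (begin
    zeros n ++ c ++ r         ≡⟨ ++-assoc (zeros n) c r ⟨
    padAbove n c ++ r         ≡⟨ eq ⟩
    zeros (n + m) ++ s        ≡⟨ cong (_++ s) (zeros-+ n m) ⟩
    (zeros n ++ zeros m) ++ s ≡⟨ ++-assoc (zeros n) (zeros m) s ⟩
    zeros n ++ zeros m ++ s   ∎))
    where open ≡-Reasoning

  padBelow≢padAbove : ∀ {n a} → NonzeroWithin n a → ∀ m c → padBelow m a ≢ padAbove n c
  padBelow≢padAbove nz m c = nz (zeros m) c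

  FlatOp : Set
  FlatOp = FlatLabel → FlatLabel → List FlatLabel

  appendCol : Col → FlatLabel → FlatLabel
  appendCol c (n , w) = (n , w ∷ʳ c)

  shiftedShuffles : FlatLabel → FlatLabel → List (List Col)
  shiftedShuffles (n₁ , u) (n₂ , v) = map (padBelow n₂) u ⧢ map (padAbove n₁) v

  infix 6 _⧢ᶠ_ _≺ᶠ_ _≻ᶠ_

  _⧢ᶠ_ : FlatOp
  (n₁ , u) ⧢ᶠ (n₂ , v) = map (n₁ + n₂ ,_) (shiftedShuffles (n₁ , u) (n₂ , v))

  _≺ᶠ_ : FlatOp
  (suc n₁ , u) ≺ᶠ (suc n₂ , v) = map (suc n₁ + suc n₂ ,_)
    (filter (lastIs? (last (map (padBelow (suc n₂)) u))) (shiftedShuffles (suc n₁ , u) (suc n₂ , v)))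
  _ ≺ᶠ _ = []

  _≻ᶠ_ : FlatOp
  (suc n₁ , u) ≻ᶠ (suc n₂ , v) = map (suc n₁ + suc n₂ ,_)
    (filter (lastIs? (last (map (padAbove (suc n₁)) v))) (shiftedShuffles (suc n₁ , u) (suc n₂ , v)))
  _ ≻ᶠ _ = []

  ⧢ᶠ-∷ʳ : ∀ n₁ u a n₂ v b →
          (n₁ , u ∷ʳ a) ⧢ᶠ (n₂ , v ∷ʳ b) ↭
          map (appendCol (padBelow n₂ a)) ((n₁ , u) ⧢ᶠ (n₂ , v ∷ʳ b)) ++
          map (appendCol (padAbove n₁ b)) ((n₁ , u ∷ʳ a) ⧢ᶠ (n₂ , v))
  ⧢ᶠ-∷ʳ n₁ u a n₂ v b
    rewrite map-++ (padBelow n₂) u [ a ] | map-++ (padAbove n₁) v [ b ] =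
    ↭-trans (map⁺ (n₁ + n₂ ,_) (∷ʳ-⧢-∷ʳ U a′ V b′)) (↭-reflexive (begin
      map (n₁ + n₂ ,_) (map (_∷ʳ a′) (U ⧢ (V ∷ʳ b′)) ++ map (_∷ʳ b′) ((U ∷ʳ a′) ⧢ V))
        ≡⟨ map-++ (n₁ + n₂ ,_) (map (_∷ʳ a′) (U ⧢ (V ∷ʳ b′))) (map (_∷ʳ b′) ((U ∷ʳ a′) ⧢ V)) ⟩
      map (n₁ + n₂ ,_) (map (_∷ʳ a′) (U ⧢ (V ∷ʳ b′))) ++ map (n₁ + n₂ ,_) (map (_∷ʳ b′) ((U ∷ʳ a′) ⧢ V))
        ≡⟨ cong₂ _++_ (map-comm (λ _ → refl) (U ⧢ (V ∷ʳ b′))) (map-comm (λ _ → refl) ((U ∷ʳ a′) ⧢ V)) ⟩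
      map (appendCol a′) (map (n₁ + n₂ ,_) (U ⧢ (V ∷ʳ b′))) ++ map (appendCol b′) (map (n₁ + n₂ ,_) ((U ∷ʳ a′) ⧢ V)) ∎))
    where
    open ≡-Reasoning
    U = map (padBelow n₂) u
    V = map (padAbove n₁) v
    a′ = padBelow n₂ a
    b′ = padAbove n₁ b

  ≺ᶠ-∷ʳ : ∀ {n₁ n₂} u a v → NonzeroWithin (suc n₁) a →
          (suc n₁ , u ∷ʳ a) ≺ᶠ (suc n₂ , v) ↭ map (appendCol (padBelow (suc n₂) a)) ((suc n₁ , u) ⧢ᶠ (suc n₂ , v))
  ≺ᶠ-∷ʳ {n₁} {n₂} u a v nz
    rewrite map-++ (padBelow (suc n₂)) u [ a ] | last-∷ʳ (map (padBelow (suc n₂)) u) (padBelow (suc n₂) a) =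
    ↭-trans (map⁺ (suc n₁ + suc n₂ ,_) (filter-lastIs-∷ʳ⧢ (map (padBelow (suc n₂)) u) (padBelow (suc n₂) a)
                                          (map (padAbove (suc n₁)) v) (All-map⁺ (universal separated v))))
            (↭-reflexive (map-comm (λ _ → refl) _))
    where
    separated : ∀ c → padAbove (suc n₁) c ≢ padBelow (suc n₂) a
    separated c = ≢-sym (padBelow≢padAbove nz (suc n₂) c)

  ≻ᶠ-∷ʳ : ∀ {n₁ n₂} u v b → All (NonzeroWithin (suc n₁)) u →
          (suc n₁ , u) ≻ᶠ (suc n₂ , v ∷ʳ b) ↭ map (appendCol (padAbove (suc n₁) b)) ((suc n₁ , u) ⧢ᶠ (suc n₂ , v))
  ≻ᶠ-∷ʳ {n₁} {n₂} u v b nzs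
    rewrite map-++ (padAbove (suc n₁)) v [ b ] | last-∷ʳ (map (padAbove (suc n₁)) v) (padAbove (suc n₁) b) =
    ↭-trans (map⁺ (suc n₁ + suc n₂ ,_) (filter-lastIs-⧢∷ʳ (map (padBelow (suc n₂)) u) (map (padAbove (suc n₁)) v)
                                          (padAbove (suc n₁) b) (All-map⁺ (All.map separated nzs))))
            (↭-reflexive (map-comm (λ _ → refl) _))
    where
    separated : ∀ {c} → NonzeroWithin (suc n₁) c → padBelow (suc n₂) c ≢ padAbove (suc n₁) b
    separated nz = padBelow≢padAbove nz (suc n₂) b

  data ColumnsNonzero : FlatLabel → Set where
    columnsNonzero : ∀ {n} u a → All (NonzeroWithin (suc n)) (u ∷ʳ a) → ColumnsNonzero (suc n , u ∷ʳ a)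

  nonempty-ColumnsNonzero : ∀ {n} w → w ≢ [] → All (NonzeroWithin (suc n)) w → ColumnsNonzero (suc n , w)
  nonempty-ColumnsNonzero w w≢[] nz with initLast w
  ... | []      = ⊥-elim (w≢[] refl)
  ... | u ∷ʳ′ a = columnsNonzero u a nz

  ⧢ᶠ-split : ∀ {x y} → ColumnsNonzero x → ColumnsNonzero y → x ⧢ᶠ y ↭ x ≺ᶠ y ++ x ≻ᶠ y
  ⧢ᶠ-split (columnsNonzero u a nzu) (columnsNonzero v b _) =
    ↭-trans (⧢ᶠ-∷ʳ _ u a _ v b)
            (↭-sym (↭-++⁺ (≺ᶠ-∷ʳ u a (v ∷ʳ b) (proj₂ (∷ʳ⁻ nzu))) (≻ᶠ-∷ʳ (u ∷ʳ a) v b nzu)))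

  concatMap-⧢ᶠˡ : ∀ n (W : List (List Col)) n₃ w →
    concatMap (_⧢ᶠ (n₃ , w)) (map (n ,_) W) ≡
    map (n + n₃ ,_) (concatMap (_⧢ map (padAbove n) w) (map (map (padBelow n₃)) W))
  concatMap-⧢ᶠˡ n W n₃ w = begin
    concatMap (_⧢ᶠ (n₃ , w)) (map (n ,_) W)
      ≡⟨ concatMap-map (_⧢ᶠ (n₃ , w)) (n ,_) W ⟩
    concatMap (map (n + n₃ ,_) ∘ ((_⧢ map (padAbove n) w) ∘ map (padBelow n₃))) W
      ≡⟨ map-concatMap (n + n₃ ,_) ((_⧢ map (padAbove n) w) ∘ map (padBelow n₃)) W ⟨
    map (n + n₃ ,_) (concatMap ((_⧢ map (padAbove n) w) ∘ map (padBelow n₃)) W)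
      ≡⟨ cong (map (n + n₃ ,_)) (concatMap-map (_⧢ map (padAbove n) w) (map (padBelow n₃)) W) ⟨
    map (n + n₃ ,_) (concatMap (_⧢ map (padAbove n) w) (map (map (padBelow n₃)) W)) ∎
    where open ≡-Reasoning

  concatMap-⧢ᶠʳ : ∀ n₁ u n (W : List (List Col)) →
    concatMap ((n₁ , u) ⧢ᶠ_) (map (n ,_) W) ≡
    map (n₁ + n ,_) (concatMap (map (padBelow n) u ⧢_) (map (map (padAbove n₁)) W))
  concatMap-⧢ᶠʳ n₁ u n W = begin
    concatMap ((n₁ , u) ⧢ᶠ_) (map (n ,_) W)
      ≡⟨ concatMap-map ((n₁ , u) ⧢ᶠ_) (n ,_) W ⟩
    concatMap (map (n₁ + n ,_) ∘ ((map (padBelow n) u ⧢_) ∘ map (padAbove n₁))) W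
      ≡⟨ map-concatMap (n₁ + n ,_) ((map (padBelow n) u ⧢_) ∘ map (padAbove n₁)) W ⟨
    map (n₁ + n ,_) (concatMap ((map (padBelow n) u ⧢_) ∘ map (padAbove n₁)) W)
      ≡⟨ cong (map (n₁ + n ,_)) (concatMap-map (map (padBelow n) u ⧢_) (map (padAbove n₁)) W) ⟨
    map (n₁ + n ,_) (concatMap (map (padBelow n) u ⧢_) (map (map (padAbove n₁)) W)) ∎
    where open ≡-Reasoning

  ⧢ᶠ-assoc : ∀ x y z → concatMap (_⧢ᶠ z) (x ⧢ᶠ y) ↭ concatMap (x ⧢ᶠ_) (y ⧢ᶠ z)
  ⧢ᶠ-assoc (n₁ , u) (n₂ , v) (n₃ , w) = begin
    concatMap (_⧢ᶠ (n₃ , w)) ((n₁ , u) ⧢ᶠ (n₂ , v))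
      ≡⟨ concatMap-⧢ᶠˡ (n₁ + n₂) (R n₂ u ⧢ L n₁ v) n₃ w ⟩
    map (n₁ + n₂ + n₃ ,_) (concatMap (_⧢ L (n₁ + n₂) w) (map (R n₃) (R n₂ u ⧢ L n₁ v)))
      ≡⟨ cong (λ W → map (n₁ + n₂ + n₃ ,_) (concatMap (_⧢ L (n₁ + n₂) w) W)) (map-⧢ (padBelow n₃) (R n₂ u) (L n₁ v)) ⟩
    map (n₁ + n₂ + n₃ ,_) (concatMap (_⧢ L (n₁ + n₂) w) (R n₃ (R n₂ u) ⧢ R n₃ (L n₁ v)))
      ↭⟨ map⁺ (n₁ + n₂ + n₃ ,_) (⧢-assoc (R n₃ (R n₂ u)) (R n₃ (L n₁ v)) (L (n₁ + n₂) w)) ⟩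
    map (n₁ + n₂ + n₃ ,_) (concatMap (R n₃ (R n₂ u) ⧢_) (R n₃ (L n₁ v) ⧢ L (n₁ + n₂) w))
      ≡⟨ cong (λ N → map (N ,_) (concatMap (R n₃ (R n₂ u) ⧢_) (R n₃ (L n₁ v) ⧢ L (n₁ + n₂) w))) (+-assoc n₁ n₂ n₃) ⟩
    map (n₁ + (n₂ + n₃) ,_) (concatMap (R n₃ (R n₂ u) ⧢_) (R n₃ (L n₁ v) ⧢ L (n₁ + n₂) w))
      ≡⟨ cong₂ (λ u′ W → map (n₁ + (n₂ + n₃) ,_) (concatMap (u′ ⧢_) W))
           (map-fuse (padBelow-padBelow n₂ n₃) u)
           (cong₂ _⧢_ (map-comm (padBelow-padAbove n₁ n₃) v) (sym (map-fuse (padAbove-padAbove n₂ n₁) w))) ⟩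
    map (n₁ + (n₂ + n₃) ,_) (concatMap (R (n₂ + n₃) u ⧢_) (L n₁ (R n₃ v) ⧢ L n₁ (L n₂ w)))
      ≡⟨ cong (λ W → map (n₁ + (n₂ + n₃) ,_) (concatMap (R (n₂ + n₃) u ⧢_) W)) (map-⧢ (padAbove n₁) (R n₃ v) (L n₂ w)) ⟨
    map (n₁ + (n₂ + n₃) ,_) (concatMap (R (n₂ + n₃) u ⧢_) (map (L n₁) (R n₃ v ⧢ L n₂ w)))
      ≡⟨ concatMap-⧢ᶠʳ n₁ u (n₂ + n₃) (R n₃ v ⧢ L n₂ w) ⟨
    concatMap ((n₁ , u) ⧢ᶠ_) ((n₂ , v) ⧢ᶠ (n₃ , w)) ∎
    where
    open PermutationReasoning
    R L : ℕ → List Col → List Col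
    R n = map (padBelow n)
    L n = map (padAbove n)

  ≺ᶠ-≺ᶠ : ∀ {x y z} → ColumnsNonzero x → ColumnsNonzero y → ColumnsNonzero z →
          concatMap (_≺ᶠ z) (x ≺ᶠ y) ↭ concatMap (x ≺ᶠ_) (y ⧢ᶠ z)
  ≺ᶠ-≺ᶠ {x@(suc n₁ , _)} {y@(suc n₂ , _)} {z@(suc n₃ , w)} (columnsNonzero u a nzx) (columnsNonzero _ _ _) _ = begin
    concatMap (_≺ᶠ z) (x ≺ᶠ y)
      ↭⟨ concatMap⁺ (_≺ᶠ z) (≺ᶠ-∷ʳ u a (proj₂ y) nza) ⟩
    concatMap (_≺ᶠ z) (map (appendCol a′) (x′ ⧢ᶠ y))
      ≡⟨ concatMap-map (_≺ᶠ z) (appendCol a′) (x′ ⧢ᶠ y) ⟩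
    concatMap ((_≺ᶠ z) ∘ appendCol a′) (x′ ⧢ᶠ y)
      ↭⟨ concatMap-↭-map ((_≺ᶠ z) ∘ appendCol a′) (_⧢ᶠ z) inner ⟩
    map (appendCol (padBelow (suc n₃) a′)) (concatMap (_⧢ᶠ z) (x′ ⧢ᶠ y))
      ↭⟨ map⁺ (appendCol (padBelow (suc n₃) a′)) (⧢ᶠ-assoc x′ y z) ⟩
    map (appendCol (padBelow (suc n₃) a′)) (concatMap (x′ ⧢ᶠ_) (y ⧢ᶠ z))
      ≡⟨ cong (λ c → map (appendCol c) (concatMap (x′ ⧢ᶠ_) (y ⧢ᶠ z))) (padBelow-padBelow (suc n₂) (suc n₃) a) ⟩
    map (appendCol (padBelow (suc n₂ + suc n₃) a)) (concatMap (x′ ⧢ᶠ_) (y ⧢ᶠ z))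
      ↭⟨ concatMap-↭-map (x ≺ᶠ_) (x′ ⧢ᶠ_) outer ⟨
    concatMap (x ≺ᶠ_) (y ⧢ᶠ z) ∎
    where
    open PermutationReasoning
    x′ : FlatLabel
    x′ = (suc n₁ , u)
    a′ : Col
    a′ = padBelow (suc n₂) a
    nza : NonzeroWithin (suc n₁) a
    nza = proj₂ (∷ʳ⁻ nzx)
    inner : All (λ l → appendCol a′ l ≺ᶠ z ↭ map (appendCol (padBelow (suc n₃) a′)) (l ⧢ᶠ z)) (x′ ⧢ᶠ y)
    inner = All-map⁺ (universal (λ W → ≺ᶠ-∷ʳ W a′ w (padBelow-NonzeroWithin (suc n₂) nza)) (shiftedShuffles x′ y))
    outer : All (λ l → x ≺ᶠ l ↭ map (appendCol (padBelow (suc n₂ + suc n₃) a)) (x′ ⧢ᶠ l)) (y ⧢ᶠ z)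
    outer = All-map⁺ (universal (λ W → ≺ᶠ-∷ʳ u a W nza) (shiftedShuffles y z))

  ≻ᶠ-≺ᶠ : ∀ {x y z} → ColumnsNonzero x → ColumnsNonzero y → ColumnsNonzero z →
          concatMap (_≺ᶠ z) (x ≻ᶠ y) ↭ concatMap (x ≻ᶠ_) (y ≺ᶠ z)
  ≻ᶠ-≺ᶠ {x@(suc n₁ , X)} {y@(suc n₂ , _)} {z@(suc n₃ , w)} (columnsNonzero _ _ nzx) (columnsNonzero v b nzy) _ = begin
    concatMap (_≺ᶠ z) (x ≻ᶠ y)
      ↭⟨ concatMap⁺ (_≺ᶠ z) (≻ᶠ-∷ʳ X v b nzx) ⟩
    concatMap (_≺ᶠ z) (map (appendCol b′) (x ⧢ᶠ y′))
      ≡⟨ concatMap-map (_≺ᶠ z) (appendCol b′) (x ⧢ᶠ y′) ⟩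
    concatMap ((_≺ᶠ z) ∘ appendCol b′) (x ⧢ᶠ y′)
      ↭⟨ concatMap-↭-map ((_≺ᶠ z) ∘ appendCol b′) (_⧢ᶠ z) inner ⟩
    map (appendCol (padBelow (suc n₃) b′)) (concatMap (_⧢ᶠ z) (x ⧢ᶠ y′))
      ↭⟨ map⁺ (appendCol (padBelow (suc n₃) b′)) (⧢ᶠ-assoc x y′ z) ⟩
    map (appendCol (padBelow (suc n₃) b′)) (concatMap (x ⧢ᶠ_) (y′ ⧢ᶠ z))
      ≡⟨ cong (λ c → map (appendCol c) (concatMap (x ⧢ᶠ_) (y′ ⧢ᶠ z))) (padBelow-padAbove (suc n₁) (suc n₃) b) ⟩
    map (appendCol (padAbove (suc n₁) b″)) (concatMap (x ⧢ᶠ_) (y′ ⧢ᶠ z))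
      ↭⟨ concatMap-↭-map ((x ≻ᶠ_) ∘ appendCol b″) (x ⧢ᶠ_) outer ⟨
    concatMap ((x ≻ᶠ_) ∘ appendCol b″) (y′ ⧢ᶠ z)
      ≡⟨ concatMap-map (x ≻ᶠ_) (appendCol b″) (y′ ⧢ᶠ z) ⟨
    concatMap (x ≻ᶠ_) (map (appendCol b″) (y′ ⧢ᶠ z))
      ↭⟨ concatMap⁺ (x ≻ᶠ_) (≺ᶠ-∷ʳ v b w nzb) ⟨
    concatMap (x ≻ᶠ_) (y ≺ᶠ z) ∎
    where
    open PermutationReasoning
    y′ : FlatLabel
    y′ = (suc n₂ , v)
    b′ b″ : Col
    b′ = padAbove (suc n₁) b
    b″ = padBelow (suc n₃) b
    nzb : NonzeroWithin (suc n₂) b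
    nzb = proj₂ (∷ʳ⁻ nzy)
    inner : All (λ l → appendCol b′ l ≺ᶠ z ↭ map (appendCol (padBelow (suc n₃) b′)) (l ⧢ᶠ z)) (x ⧢ᶠ y′)
    inner = All-map⁺ (universal (λ W → ≺ᶠ-∷ʳ W b′ w (padAbove-NonzeroWithin (suc n₁) nzb)) (shiftedShuffles x y′))
    outer : All (λ l → x ≻ᶠ appendCol b″ l ↭ map (appendCol (padAbove (suc n₁) b″)) (x ⧢ᶠ l)) (y′ ⧢ᶠ z)
    outer = All-map⁺ (universal (λ W → ≻ᶠ-∷ʳ X W b″ nzx) (shiftedShuffles y′ z))

  ⧢ᶠ-≻ᶠ : ∀ {x y z} → ColumnsNonzero x → ColumnsNonzero y → ColumnsNonzero z →
          concatMap (_≻ᶠ z) (x ⧢ᶠ y) ↭ concatMap (x ≻ᶠ_) (y ≻ᶠ z)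
  ⧢ᶠ-≻ᶠ {x@(suc n₁ , X)} {y@(suc n₂ , Y)} {z@(suc n₃ , _)}
        (columnsNonzero _ _ nzx) (columnsNonzero _ _ nzy) (columnsNonzero w c _) = begin
    concatMap (_≻ᶠ z) (x ⧢ᶠ y)
      ↭⟨ concatMap-↭-map (_≻ᶠ z) (_⧢ᶠ z′) inner ⟩
    map (appendCol (padAbove (suc n₁ + suc n₂) c)) (concatMap (_⧢ᶠ z′) (x ⧢ᶠ y))
      ↭⟨ map⁺ (appendCol (padAbove (suc n₁ + suc n₂) c)) (⧢ᶠ-assoc x y z′) ⟩
    map (appendCol (padAbove (suc n₁ + suc n₂) c)) (concatMap (x ⧢ᶠ_) (y ⧢ᶠ z′))
      ≡⟨ cong (λ c″ → map (appendCol c″) (concatMap (x ⧢ᶠ_) (y ⧢ᶠ z′))) (padAbove-padAbove (suc n₂) (suc n₁) c) ⟨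
    map (appendCol (padAbove (suc n₁) c′)) (concatMap (x ⧢ᶠ_) (y ⧢ᶠ z′))
      ↭⟨ concatMap-↭-map ((x ≻ᶠ_) ∘ appendCol c′) (x ⧢ᶠ_) outer ⟨
    concatMap ((x ≻ᶠ_) ∘ appendCol c′) (y ⧢ᶠ z′)
      ≡⟨ concatMap-map (x ≻ᶠ_) (appendCol c′) (y ⧢ᶠ z′) ⟨
    concatMap (x ≻ᶠ_) (map (appendCol c′) (y ⧢ᶠ z′))
      ↭⟨ concatMap⁺ (x ≻ᶠ_) (≻ᶠ-∷ʳ Y w c nzy) ⟨
    concatMap (x ≻ᶠ_) (y ≻ᶠ z) ∎
    where
    open PermutationReasoning
    z′ : FlatLabel
    z′ = (suc n₃ , w)
    c′ : Col
    c′ = padAbove (suc n₂) c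
    shuffledColumnsNonzero : All (All (NonzeroWithin (suc n₁ + suc n₂))) (shiftedShuffles x y)
    shuffledColumnsNonzero = ⧢-All (All-map⁺ (All.map (padBelow-NonzeroWithin (suc n₂)) nzx))
                                    (All-map⁺ (All.map (padAbove-NonzeroWithin (suc n₁)) nzy))
    inner : All (λ l → l ≻ᶠ z ↭ map (appendCol (padAbove (suc n₁ + suc n₂) c)) (l ⧢ᶠ z′)) (x ⧢ᶠ y)
    inner = All-map⁺ (All.map (λ {W} → ≻ᶠ-∷ʳ W w c) shuffledColumnsNonzero)
    outer : All (λ l → x ≻ᶠ appendCol c′ l ↭ map (appendCol (padAbove (suc n₁) c′)) (x ⧢ᶠ l)) (y ⧢ᶠ z′)
    outer = All-map⁺ (universal (λ W → ≻ᶠ-∷ʳ X W c′ nzx) (shiftedShuffles y z′))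

-- Finite formal linear combinations over a commutative ring

module Combinations {c ℓ} (R : CommutativeRing c ℓ) where
  open CommutativeRing R
    using (Carrier; _≈_; 0#; +-cong; +-congˡ; +-identityˡ; *-assoc; +-commutativeSemigroup)
    renaming (_+_ to _+ᴿ_; _*_ to _*ᴿ_; +-assoc to +ᴿ-assoc; refl to ≈-refl; sym to ≈-sym; trans to ≈-trans)
  open CommutativeSemigroupProperties +-commutativeSemigroup using (x∙yz≈y∙xz)

  private
    variable
      L L′ : Set

  coeff : (L → L → Bool) → List (Carrier × L) → L → Carrier
  coeff _==_ x l = foldr (λ t s → if proj₂ t == l then proj₁ t +ᴿ s else s) 0# x

  infixl 7 _⊗⟨_⟩_

  _⊗⟨_⟩_ : Carrier × L → (L → L → List L) → Carrier × L → List (Carrier × L)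
  t ⊗⟨ op ⟩ u = map (proj₁ t *ᴿ proj₁ u ,_) (op (proj₂ t) (proj₂ u))

  bilinear : (L → L → List L) → List (Carrier × L) → List (Carrier × L) → List (Carrier × L)
  bilinear op x y = concatMap (λ t → concatMap (t ⊗⟨ op ⟩_) y) x

  relabel : (L → L′) → List (Carrier × L) → List (Carrier × L′)
  relabel f = map (map₂ f)

  coeff-relabel : (_==_ : L → L → Bool) (_==′_ : L′ → L′ → Bool) (f : L → L′) {l₀ : L} →
                  (∀ l → (l == l₀) ≡ (f l ==′ f l₀)) →
                  ∀ x → coeff _==_ x l₀ ≡ coeff _==′_ (relabel f x) (f l₀)
  coeff-relabel _==_ _==′_ f eq []            = refl
  coeff-relabel _==_ _==′_ f eq ((a , l) ∷ x) =
    cong₂ (λ b s → if b then a +ᴿ s else s) (eq l) (coeff-relabel _==_ _==′_ f eq x)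

  relabel-bilinear : {op : L → L → List L} {op′ : L′ → L′ → List L′} (f : L → L′) →
                     (∀ l l′ → map f (op l l′) ≡ op′ (f l) (f l′)) →
                     ∀ x y → relabel f (bilinear op x y) ≡ bilinear op′ (relabel f x) (relabel f y)
  relabel-bilinear {op = op} {op′} f hom x y = begin
    relabel f (bilinear op x y)
      ≡⟨ map-concatMap (map₂ f) _ x ⟩
    concatMap (λ t → relabel f (concatMap (t ⊗⟨ op ⟩_) y)) x
      ≡⟨ concatMap-cong (λ t → trans (map-concatMap (map₂ f) _ y) (concatMap-cong (relabel-⊗ t) y)) x ⟩
    concatMap (λ t → concatMap (λ u → map₂ f t ⊗⟨ op′ ⟩ map₂ f u) y) x
      ≡⟨ concatMap-cong (λ t → concatMap-map (map₂ f t ⊗⟨ op′ ⟩_) (map₂ f) y) x ⟨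
    concatMap (λ t → concatMap (map₂ f t ⊗⟨ op′ ⟩_) (relabel f y)) x
      ≡⟨ concatMap-map (λ t → concatMap (t ⊗⟨ op′ ⟩_) (relabel f y)) (map₂ f) x ⟨
    bilinear op′ (relabel f x) (relabel f y) ∎
    where
    open ≡-Reasoning
    relabel-⊗ : ∀ t u → relabel f (t ⊗⟨ op ⟩ u) ≡ map₂ f t ⊗⟨ op′ ⟩ map₂ f u
    relabel-⊗ (a , l) (b , l′) = trans (map-comm (λ _ → refl) (op l l′)) (cong (map (a *ᴿ b ,_)) (hom l l′))

  bilinear-++-↭ : (P : L → Set) (op op₁ op₂ : L → L → List L) →
                  (∀ {l₁ l₂} → P l₁ → P l₂ → op l₁ l₂ ↭ op₁ l₁ l₂ ++ op₂ l₁ l₂) →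
                  ∀ {x y} → All (P ∘ proj₂) x → All (P ∘ proj₂) y →
                  bilinear op x y ↭ bilinear op₁ x y ++ bilinear op₂ x y
  bilinear-++-↭ P op op₁ op₂ hyp {x} {y} px py = begin
    concatMap (λ t → concatMap (t ⊗⟨ op ⟩_) y) x
      ↭⟨ concatMap-cong-↭ (All.map (λ pt → concatMap-cong-↭ (All.map (λ pu → ⊗-split pt pu) py)) px) ⟩
    concatMap (λ t → concatMap (λ u → t ⊗⟨ op₁ ⟩ u ++ t ⊗⟨ op₂ ⟩ u) y) x
      ↭⟨ concatMap-cong-↭ (universal (λ t → concatMap-++-↭ (t ⊗⟨ op₁ ⟩_) (t ⊗⟨ op₂ ⟩_) y) x) ⟩
    concatMap (λ t → concatMap (t ⊗⟨ op₁ ⟩_) y ++ concatMap (t ⊗⟨ op₂ ⟩_) y) x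
      ↭⟨ concatMap-++-↭ (λ t → concatMap (t ⊗⟨ op₁ ⟩_) y) (λ t → concatMap (t ⊗⟨ op₂ ⟩_) y) x ⟩
    bilinear op₁ x y ++ bilinear op₂ x y ∎
    where
    open PermutationReasoning
    ⊗-split : ∀ {t u} → P (proj₂ t) → P (proj₂ u) → t ⊗⟨ op ⟩ u ↭ t ⊗⟨ op₁ ⟩ u ++ t ⊗⟨ op₂ ⟩ u
    ⊗-split {a , l₁} {b , l₂} p₁ p₂ =
      ↭-trans (map⁺ (a *ᴿ b ,_) (hyp p₁ p₂)) (↭-reflexive (map-++ (a *ᴿ b ,_) (op₁ l₁ l₂) (op₂ l₁ l₂)))

  module CoefficientEquality (_==_ : L → L → Bool) where

    infix 4 _≃_

    record _≃_ (x y : List (Carrier × L)) : Set ℓ where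
      constructor mk≃
      field coeff-≈ : ∀ l → coeff _==_ x l ≈ coeff _==_ y l

    open _≃_

    ≃-setoid : Setoid c ℓ
    ≃-setoid = record
      { Carrier       = List (Carrier × L)
      ; _≈_           = _≃_
      ; isEquivalence = record
        { refl  = mk≃ λ _ → ≈-refl
        ; sym   = λ p → mk≃ λ l → ≈-sym (coeff-≈ p l)
        ; trans = λ p q → mk≃ λ l → ≈-trans (coeff-≈ p l) (coeff-≈ q l)
        }
      }

    ↭⇒≃ : ∀ {x y} → x ↭ y → x ≃ y
    ↭⇒≃ p = mk≃ (coeff-↭ p)
      where
      coeff-↭ : ∀ {x y} → x ↭ y → ∀ l → coeff _==_ x l ≈ coeff _==_ y l
      coeff-↭ ↭.refl                       l = ≈-refl
      coeff-↭ (↭.prep (a , l′) p)          l with l′ == l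
      ... | true  = +-congˡ (coeff-↭ p l)
      ... | false = coeff-↭ p l
      coeff-↭ (↭.swap (a , l₁) (b , l₂) p) l with l₁ == l | l₂ == l
      ... | true  | true  = ≈-trans (+-congˡ (+-congˡ (coeff-↭ p l))) (x∙yz≈y∙xz a b _)
      ... | true  | false = +-congˡ (coeff-↭ p l)
      ... | false | true  = +-congˡ (coeff-↭ p l)
      ... | false | false = coeff-↭ p l
      coeff-↭ (↭.trans p q)                l = ≈-trans (coeff-↭ p l) (coeff-↭ q l)

    coeff-++ : ∀ x y l → coeff _==_ (x ++ y) l ≈ coeff _==_ x l +ᴿ coeff _==_ y l
    coeff-++ []             y l = ≈-sym (+-identityˡ _)
    coeff-++ ((a , l′) ∷ x) y l with l′ == l
    ... | true  = ≈-trans (+-congˡ (coeff-++ x y l)) (≈-sym (+ᴿ-assoc a _ _))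
    ... | false = coeff-++ x y l

    concatMap-cong-≃ : {A : Set a} {f g : A → List (Carrier × L)} {xs : List A} →
                       All (λ x → f x ≃ g x) xs → concatMap f xs ≃ concatMap g xs
    concatMap-cong-≃ []                 = mk≃ λ _ → ≈-refl
    concatMap-cong-≃ {f = f} {g} {x ∷ xs} (p ∷ ps) = mk≃ λ l → ≈-trans (coeff-++ (f x) _ l)
      (≈-trans (+-cong (coeff-≈ p l) (coeff-≈ (concatMap-cong-≃ ps) l)) (≈-sym (coeff-++ (g x) _ l)))

    scale-cong : ∀ {a b} → a ≈ b → (ls : List L) → map (a ,_) ls ≃ map (b ,_) ls
    scale-cong {a} {b} a≈b ls = mk≃ (coeff-scale ls)
      where
      coeff-scale : ∀ ls l → coeff _==_ (map (a ,_) ls) l ≈ coeff _==_ (map (b ,_) ls) l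
      coeff-scale []        l = ≈-refl
      coeff-scale (l′ ∷ ls) l with l′ == l
      ... | true  = +-cong a≈b (coeff-scale ls l)
      ... | false = coeff-scale ls l

    bilinear-assoc : (P : L → Set) (op₁ op₂ op₃ op₄ : L → L → List L) →
      (∀ {l₁ l₂ l₃} → P l₁ → P l₂ → P l₃ →
         concatMap (λ l → op₂ l l₃) (op₁ l₁ l₂) ↭ concatMap (op₄ l₁) (op₃ l₂ l₃)) →
      ∀ {x y z} → All (P ∘ proj₂) x → All (P ∘ proj₂) y → All (P ∘ proj₂) z →
      bilinear op₂ (bilinear op₁ x y) z ≃ bilinear op₄ x (bilinear op₃ y z)
    bilinear-assoc P op₁ op₂ op₃ op₄ hyp {x} {y} {z} px py pz = begin
      bilinear op₂ (bilinear op₁ x y) z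
        ≡⟨ trans (concatMap-concatMap (λ s → concatMap (s ⊗⟨ op₂ ⟩_) z) _ x)
                 (concatMap-cong (λ t → concatMap-concatMap (λ s → concatMap (s ⊗⟨ op₂ ⟩_) z) (t ⊗⟨ op₁ ⟩_) y) x) ⟩
      concatMap (λ t → concatMap (λ u → concatMap (λ s → concatMap (s ⊗⟨ op₂ ⟩_) z) (t ⊗⟨ op₁ ⟩ u)) y) x
        ≈⟨ ↭⇒≃ (concatMap-cong-↭ (universal (λ t → concatMap-cong-↭ (universal (λ u →
             concatMap-comm (λ s v → s ⊗⟨ op₂ ⟩ v) (t ⊗⟨ op₁ ⟩ u) z) y)) x)) ⟩
      concatMap (λ t → concatMap (λ u → concatMap (λ v → concatMap (_⊗⟨ op₂ ⟩ v) (t ⊗⟨ op₁ ⟩ u)) z) y) x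
        ≈⟨ concatMap-cong-≃ (All.map (λ pt → concatMap-cong-≃ (All.map (λ pu → concatMap-cong-≃ (All.map (λ pv →
             ⊗-assoc pt pu pv) pz)) py)) px) ⟩
      concatMap (λ t → concatMap (λ u → concatMap (λ v → concatMap (t ⊗⟨ op₄ ⟩_) (u ⊗⟨ op₃ ⟩ v)) z) y) x
        ≡⟨ concatMap-cong (λ t → trans (concatMap-concatMap (t ⊗⟨ op₄ ⟩_) _ y)
             (concatMap-cong (λ u → concatMap-concatMap (t ⊗⟨ op₄ ⟩_) (u ⊗⟨ op₃ ⟩_) z) y)) x ⟨
      bilinear op₄ x (bilinear op₃ y z) ∎
      where
      open SetoidReasoning ≃-setoid
      ⊗-assoc : ∀ {t u v} → P (proj₂ t) → P (proj₂ u) → P (proj₂ v) →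
                concatMap (_⊗⟨ op₂ ⟩ v) (t ⊗⟨ op₁ ⟩ u) ≃ concatMap (t ⊗⟨ op₄ ⟩_) (u ⊗⟨ op₃ ⟩ v)
      ⊗-assoc {a , l₁} {b , l₂} {c , l₃} p₁ p₂ p₃ = begin
        concatMap (_⊗⟨ op₂ ⟩ (c , l₃)) (map (a *ᴿ b ,_) (op₁ l₁ l₂))
          ≡⟨ trans (concatMap-map (_⊗⟨ op₂ ⟩ (c , l₃)) (a *ᴿ b ,_) (op₁ l₁ l₂))
                   (sym (map-concatMap ((a *ᴿ b) *ᴿ c ,_) (λ l → op₂ l l₃) (op₁ l₁ l₂))) ⟩
        map ((a *ᴿ b) *ᴿ c ,_) (concatMap (λ l → op₂ l l₃) (op₁ l₁ l₂))
          ≈⟨ scale-cong (*-assoc a b c) (concatMap (λ l → op₂ l l₃) (op₁ l₁ l₂)) ⟩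
        map (a *ᴿ (b *ᴿ c) ,_) (concatMap (λ l → op₂ l l₃) (op₁ l₁ l₂))
          ≈⟨ ↭⇒≃ (map⁺ (a *ᴿ (b *ᴿ c) ,_) (hyp p₁ p₂ p₃)) ⟩
        map (a *ᴿ (b *ᴿ c) ,_) (concatMap (op₄ l₁) (op₃ l₂ l₃))
          ≡⟨ trans (concatMap-map ((a , l₁) ⊗⟨ op₄ ⟩_) (b *ᴿ c ,_) (op₃ l₂ l₃))
                   (sym (map-concatMap (a *ᴿ (b *ᴿ c) ,_) (op₄ l₁) (op₃ l₂ l₃))) ⟨
        concatMap ((a , l₁) ⊗⟨ op₄ ⟩_) (map (b *ᴿ c ,_) (op₃ l₂ l₃)) ∎

toList-injective′ : ∀ {n} (xs ys : Vec A n) → toList xs ≡ toList ys → xs ≡ ys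
toList-injective′ xs ys eq = trans (sym (cast-is-id refl xs)) (Vec.toList-injective refl xs ys eq)

toList-subst : ∀ {m n} (eq : m ≡ n) (xs : Vec A m) → toList (subst (Vec A) eq xs) ≡ toList xs
toList-subst eq xs = trans (cong toList (Vec.subst-is-cast eq xs)) (Vec.toList-cast eq xs)

toList-shuffles : ∀ {m n} (xs : Vec A m) (ys : Vec A n) → map toList (shuffles xs ys) ≡ toList xs ⧢ toList ys
toList-shuffles []       ys       = refl
toList-shuffles (x ∷ xs) []       = cong [_] (toList-subst _ (x ∷ xs))
toList-shuffles {A = A} {suc m} {suc n} (x ∷ xs) (y ∷ ys) = begin
  map toList (map (x ∷_) (shuffles xs (y ∷ ys)) ++ map (λ v → subst (Vec A) _ (y ∷ v)) (shuffles (x ∷ xs) ys))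
    ≡⟨ map-++ toList (map (x ∷_) (shuffles xs (y ∷ ys))) _ ⟩
  map toList (map (x ∷_) (shuffles xs (y ∷ ys))) ++ map toList (map (λ v → subst (Vec A) _ (y ∷ v)) (shuffles (x ∷ xs) ys))
    ≡⟨ cong₂ _++_ (map-comm (λ _ → refl) (shuffles xs (y ∷ ys)))
                  (map-comm (λ v → toList-subst _ (y ∷ v)) (shuffles (x ∷ xs) ys)) ⟩
  map (x ∷_) (map toList (shuffles xs (y ∷ ys))) ++ map (y ∷_) (map toList (shuffles (x ∷ xs) ys))
    ≡⟨ cong₂ (λ l r → map (x ∷_) l ++ map (y ∷_) r) (toList-shuffles xs (y ∷ ys)) (toList-shuffles (x ∷ xs) ys) ⟩
  toList (x ∷ xs) ⧢ toList (y ∷ ys) ∎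
  where open ≡-Reasoning

last-toList : ∀ {n} (xs : Vec A (suc n)) → last (toList xs) ≡ just (Vec.last xs)
last-toList (x ∷ [])     = refl
last-toList (x ∷ y ∷ xs) = last-toList (y ∷ xs)

-- Transport of PM_k to combinations of flat labels

module Transfer {c ℓ} (R : CommutativeRing c ℓ) (k : ℕ) where
  open CommutativeRing R using (Carrier) renaming (reflexive to ≈-reflexive; sym to ≈-sym; trans to ≈-trans)
  open Space R k
  open Flat k
  module C = Combinations R

  columns : ∀ {m n} → Vec (Vec (Entry k) m) n → List Col
  columns M = map toList (toList M)

  flatten : Label → FlatLabel
  flatten (n , M) = (n , columns M)

  ⟦_⟧ : PM → List (Carrier × FlatLabel)
  ⟦_⟧ = C.relabel flatten

  -- Defined like sameLabel, by first comparing sizes, so that the two tests unfold in step.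
  _==ᶠ_ : FlatLabel → FlatLabel → Bool
  (n′ , w′) ==ᶠ (n , w) with n′ Nat.≟ n
  ... | yes _ = does (List.≡-dec _≟ᶜ_ w′ w)
  ... | no _  = false

  open C.CoefficientEquality _==ᶠ_

  columns-injective : ∀ {m n} (M M′ : Vec (Vec (Entry k) m) n) → columns M ≡ columns M′ → M ≡ M′
  columns-injective M M′ eq = toList-injective′ M M′ (List.map-injective (λ {u} {v} → toList-injective′ u v) eq)

  sameLabel-flatten : ∀ l n (M : Matrix k n) → sameLabel l (n , M) ≡ (flatten l ==ᶠ flatten (n , M))
  sameLabel-flatten (n′ , M′) n M with n′ Nat.≟ n
  ... | yes refl = does-⇔ (mk⇔ (cong columns) (columns-injective M′ M)) (Vec.≡-dec colEq? M′ M) (List.≡-dec _≟ᶜ_ (columns M′) (columns M))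
  ... | no _     = refl

  ≋-from-≃ : ∀ {x y} → ⟦ x ⟧ ≃ ⟦ y ⟧ → x ≋ y
  ≋-from-≃ {x} {y} p n M = ≈-trans (≈-reflexive (C.coeff-relabel sameLabel _==ᶠ_ flatten (λ l → sameLabel-flatten l n M) x))
                          (≈-trans (_≃_.coeff-≈ p (n , columns M))
                                   (≈-sym (≈-reflexive (C.coeff-relabel sameLabel _==ᶠ_ flatten (λ l → sameLabel-flatten l n M) y))))

  columns-∘ᵣ : ∀ {n₁} (M : Matrix k n₁) n₂ → columns (M ∘ᵣ n₂) ≡ map (padBelow n₂) (columns M)
  columns-∘ᵣ M n₂ = trans (cong (map toList) (Vec.toList-map _ M)) (map-comm toList-padded (toList M))
    where
    toList-padded : ∀ c → toList (c Vec.++ Vec.replicate n₂ Fin.zero) ≡ padBelow n₂ (toList c)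
    toList-padded c = trans (Vec.toList-++ c _) (cong (toList c ++_) (Vec.toList-replicate n₂ Fin.zero))

  columns-∘ₗ : ∀ n₁ {n₂} (M : Matrix k n₂) → columns (n₁ ∘ₗ M) ≡ map (padAbove n₁) (columns M)
  columns-∘ₗ n₁ M = trans (cong (map toList) (Vec.toList-map _ M)) (map-comm toList-padded (toList M))
    where
    toList-padded : ∀ c → toList (Vec.replicate n₁ Fin.zero Vec.++ c) ≡ padAbove n₁ (toList c)
    toList-padded c = trans (Vec.toList-++ (Vec.replicate n₁ Fin.zero) c) (cong (_++ toList c) (Vec.toList-replicate n₁ Fin.zero))

  columns-colShuffle : ∀ {n₁ n₂} (M₁ : Matrix k n₁) (M₂ : Matrix k n₂) →
                       map columns (colShuffle M₁ M₂) ≡ shiftedShuffles (n₁ , columns M₁) (n₂ , columns M₂)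
  columns-colShuffle {n₁} {n₂} M₁ M₂ = begin
    map columns (shuffles (M₁ ∘ᵣ n₂) (n₁ ∘ₗ M₂))
      ≡⟨ map-∘ (shuffles (M₁ ∘ᵣ n₂) (n₁ ∘ₗ M₂)) ⟩
    map (map toList) (map toList (shuffles (M₁ ∘ᵣ n₂) (n₁ ∘ₗ M₂)))
      ≡⟨ cong (map (map toList)) (toList-shuffles (M₁ ∘ᵣ n₂) (n₁ ∘ₗ M₂)) ⟩
    map (map toList) (toList (M₁ ∘ᵣ n₂) ⧢ toList (n₁ ∘ₗ M₂))
      ≡⟨ map-⧢ toList (toList (M₁ ∘ᵣ n₂)) (toList (n₁ ∘ₗ M₂)) ⟩
    columns (M₁ ∘ᵣ n₂) ⧢ columns (n₁ ∘ₗ M₂)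
      ≡⟨ cong₂ _⧢_ (columns-∘ᵣ M₁ n₂) (columns-∘ₗ n₁ M₂) ⟩
    map (padBelow n₂) (columns M₁) ⧢ map (padAbove n₁) (columns M₂) ∎
    where open ≡-Reasoning

  last-columns : ∀ {m n} (M : Vec (Vec (Entry k) m) (suc n)) → last (columns M) ≡ just (toList (Vec.last M))
  last-columns M = trans (List.last-map toList (toList M)) (cong (Maybe.map toList) (last-toList M))

  lastColumn-⇔ : ∀ {m n} (M : Vec (Vec (Entry k) m) (suc n)) (c : Vec (Entry k) m) →
                 (Vec.last M ≡ c) ⇔ (last (columns M) ≡ just (toList c))
  lastColumn-⇔ M c = mk⇔ (λ eq → trans (last-columns M) (cong (just ∘ toList) eq))
                         (λ eq → toList-injective′ _ c (just-injective (trans (sym (last-columns M)) eq)))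

  LabelOp : Set
  LabelOp = ∀ {n₁ n₂} → Matrix k n₁ → Matrix k n₂ → List Label

  record Flattens (op : LabelOp) (opᶠ : FlatOp) : Set where
    field
      map-flatten : ∀ {n₁ n₂} (M₁ : Matrix k n₁) (M₂ : Matrix k n₂) →
                    map flatten (op M₁ M₂) ≡ opᶠ (n₁ , columns M₁) (n₂ , columns M₂)
  open Flattens

  shuffleLabels-flattens : Flattens shuffleLabels _⧢ᶠ_
  shuffleLabels-flattens .map-flatten {n₁} {n₂} M₁ M₂ =
    trans (map-comm (λ _ → refl) (colShuffle M₁ M₂)) (cong (map (n₁ + n₂ ,_)) (columns-colShuffle M₁ M₂))

  columns-filter-last : ∀ {n₁ n₂} (M₁ : Matrix k (suc n₁)) (M₂ : Matrix k (suc n₂)) (c : Column k (suc n₁ + suc n₂))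
                        {m : Maybe Col} → m ≡ just (toList c) →
                        map columns (filter (λ M → colEq? (Vec.last M) c) (colShuffle M₁ M₂)) ≡
                        filter (lastIs? m) (shiftedShuffles (suc n₁ , columns M₁) (suc n₂ , columns M₂))
  columns-filter-last M₁ M₂ c refl =
    trans (map-filter (λ M → colEq? (Vec.last M) c) (lastIs? (just (toList c))) columns (λ M → lastColumn-⇔ M c)
                      (colShuffle M₁ M₂))
          (cong (filter (lastIs? (just (toList c)))) (columns-colShuffle M₁ M₂))

  precLabels-flattens : Flattens precLabels _≺ᶠ_
  precLabels-flattens .map-flatten {zero}            M₁ M₂ = refl
  precLabels-flattens .map-flatten {suc n₁} {zero}   M₁ M₂ = refl
  precLabels-flattens .map-flatten {suc n₁} {suc n₂} M₁ M₂ =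
    trans (map-comm (λ _ → refl) (filter (λ M → colEq? (Vec.last M) lastCol) (colShuffle M₁ M₂)))
          (cong (map (suc n₁ + suc n₂ ,_)) (columns-filter-last M₁ M₂ lastCol
            (trans (cong last (sym (columns-∘ᵣ M₁ (suc n₂)))) (last-columns (M₁ ∘ᵣ suc n₂)))))
    where
    lastCol : Column k (suc n₁ + suc n₂)
    lastCol = Vec.last (M₁ ∘ᵣ suc n₂)

  succLabels-flattens : Flattens succLabels _≻ᶠ_
  succLabels-flattens .map-flatten {zero}            M₁ M₂ = refl
  succLabels-flattens .map-flatten {suc n₁} {zero}   M₁ M₂ = refl
  succLabels-flattens .map-flatten {suc n₁} {suc n₂} M₁ M₂ =
    trans (map-comm (λ _ → refl) (filter (λ M → colEq? (Vec.last M) lastCol) (colShuffle M₁ M₂)))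
          (cong (map (suc n₁ + suc n₂ ,_)) (columns-filter-last M₁ M₂ lastCol
            (trans (cong last (sym (columns-∘ₗ (suc n₁) M₂))) (last-columns (suc n₁ ∘ₗ M₂)))))
    where
    lastCol : Column k (suc n₁ + suc n₂)
    lastCol = Vec.last (suc n₁ ∘ₗ M₂)

  toList-NonzeroWithin : ∀ {m} (c : Column k m) → HasNonzero c → NonzeroWithin m (toList c)
  toList-NonzeroWithin (e ∷ c) (Fin.zero  , e≢0) r s eq = e≢0 (List.∷-injectiveˡ eq)
  toList-NonzeroWithin (e ∷ c) (Fin.suc i , nz)  r s eq = toList-NonzeroWithin c (i , nz) r s (List.∷-injectiveʳ eq)

  columns-NonzeroWithin : ∀ {m n} (M : Vec (Column k m) n) →
                          (∀ j → HasNonzero (Vec.lookup M j)) → All (NonzeroWithin m) (columns M)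
  columns-NonzeroWithin []      _   = []
  columns-NonzeroWithin (c ∷ M) nzs = toList-NonzeroWithin c (nzs Fin.zero) ∷ columns-NonzeroWithin M (nzs ∘ Fin.suc)

  flatten-ColumnsNonzero : ∀ {n} (M : Matrix k n) → NonZero n → IsPacked M → ColumnsNonzero (n , columns M)
  flatten-ColumnsNonzero {zero}  []      () _
  flatten-ColumnsNonzero {suc n} (c ∷ M) _  (nonzeroColumns , _) =
    nonempty-ColumnsNonzero (columns (c ∷ M)) (λ ()) (columns-NonzeroWithin (c ∷ M) nonzeroColumns)

  flatten-InPM⁺ : ∀ {x} → InPM⁺ x → All (ColumnsNonzero ∘ proj₂) ⟦ x ⟧
  flatten-InPM⁺ px = All-map⁺ (All.map (λ {t} (nz , packed) → flatten-ColumnsNonzero (proj₂ (proj₂ t)) nz packed) px)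

  flatten-bilinear : (op : LabelOp) (opᶠ : FlatOp) → Flattens op opᶠ →
                     ∀ x y → ⟦ bilinear op x y ⟧ ≡ C.bilinear opᶠ ⟦ x ⟧ ⟦ y ⟧
  flatten-bilinear op opᶠ hom = C.relabel-bilinear flatten (λ l l′ → map-flatten hom (proj₂ l) (proj₂ l′))

  ≋-split : ∀ {op op₁ op₂ : LabelOp} {opᶠ opᶠ₁ opᶠ₂ : FlatOp} → Flattens op opᶠ → Flattens op₁ opᶠ₁ → Flattens op₂ opᶠ₂ →
            (∀ {l₁ l₂} → ColumnsNonzero l₁ → ColumnsNonzero l₂ → opᶠ l₁ l₂ ↭ opᶠ₁ l₁ l₂ ++ opᶠ₂ l₁ l₂) →
            ∀ {x y} → InPM⁺ x → InPM⁺ y → bilinear op x y ≋ bilinear op₁ x y ⊕ bilinear op₂ x y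
  ≋-split {op} {op₁} {op₂} {opᶠ} {opᶠ₁} {opᶠ₂} hom hom₁ hom₂ split {x} {y} px py = ≋-from-≃ (begin
    ⟦ bilinear op x y ⟧
      ≡⟨ flatten-bilinear op opᶠ hom x y ⟩
    C.bilinear opᶠ ⟦ x ⟧ ⟦ y ⟧
      ≈⟨ ↭⇒≃ (C.bilinear-++-↭ ColumnsNonzero opᶠ opᶠ₁ opᶠ₂ split (flatten-InPM⁺ px) (flatten-InPM⁺ py)) ⟩
    C.bilinear opᶠ₁ ⟦ x ⟧ ⟦ y ⟧ ++ C.bilinear opᶠ₂ ⟦ x ⟧ ⟦ y ⟧
      ≡⟨ trans (map-++ (map₂ flatten) (bilinear op₁ x y) (bilinear op₂ x y))
               (cong₂ _++_ (flatten-bilinear op₁ opᶠ₁ hom₁ x y) (flatten-bilinear op₂ opᶠ₂ hom₂ x y)) ⟨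
    ⟦ bilinear op₁ x y ⊕ bilinear op₂ x y ⟧ ∎)
    where open SetoidReasoning ≃-setoid

  ≋-assoc : ∀ {op₁ op₂ op₃ op₄ : LabelOp} {opᶠ₁ opᶠ₂ opᶠ₃ opᶠ₄ : FlatOp} →
            Flattens op₁ opᶠ₁ → Flattens op₂ opᶠ₂ → Flattens op₃ opᶠ₃ → Flattens op₄ opᶠ₄ →
            (∀ {l₁ l₂ l₃} → ColumnsNonzero l₁ → ColumnsNonzero l₂ → ColumnsNonzero l₃ →
               concatMap (λ l → opᶠ₂ l l₃) (opᶠ₁ l₁ l₂) ↭ concatMap (opᶠ₄ l₁) (opᶠ₃ l₂ l₃)) →
            ∀ {x y z} → InPM⁺ x → InPM⁺ y → InPM⁺ z →
            bilinear op₂ (bilinear op₁ x y) z ≋ bilinear op₄ x (bilinear op₃ y z)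
  ≋-assoc {op₁} {op₂} {op₃} {op₄} {opᶠ₁} {opᶠ₂} {opᶠ₃} {opᶠ₄} hom₁ hom₂ hom₃ hom₄ assoc {x} {y} {z} px py pz = ≋-from-≃ (begin
    ⟦ bilinear op₂ (bilinear op₁ x y) z ⟧
      ≡⟨ trans (flatten-bilinear op₂ opᶠ₂ hom₂ (bilinear op₁ x y) z)
               (cong (λ w → C.bilinear opᶠ₂ w ⟦ z ⟧) (flatten-bilinear op₁ opᶠ₁ hom₁ x y)) ⟩
    C.bilinear opᶠ₂ (C.bilinear opᶠ₁ ⟦ x ⟧ ⟦ y ⟧) ⟦ z ⟧
      ≈⟨ bilinear-assoc ColumnsNonzero opᶠ₁ opᶠ₂ opᶠ₃ opᶠ₄ assoc (flatten-InPM⁺ px) (flatten-InPM⁺ py) (flatten-InPM⁺ pz) ⟩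
    C.bilinear opᶠ₄ ⟦ x ⟧ (C.bilinear opᶠ₃ ⟦ y ⟧ ⟦ z ⟧)
      ≡⟨ trans (flatten-bilinear op₄ opᶠ₄ hom₄ x (bilinear op₃ y z))
               (cong (C.bilinear opᶠ₄ ⟦ x ⟧) (flatten-bilinear op₃ opᶠ₃ hom₃ y z)) ⟨
    ⟦ bilinear op₄ x (bilinear op₃ y z) ⟧ ∎)
    where open SetoidReasoning ≃-setoid

-- The identities hold over any commutative ring and for every k.
proposition2p7 : {c ℓ : Level} (R : CommutativeRing c ℓ) → IsFieldOfCharZero R →
    (k : ℕ) → 1 ≤ k →
    let open Space R k in
    ((∀ {n₁ n₂} (M₁ : Matrix k n₁) (M₂ : Matrix k n₂) →
        NonZero n₁ → NonZero n₂ → IsPacked M₁ → IsPacked M₂ →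
        F M₁ · F M₂ ≋ F M₁ ≺ F M₂ ⊕ F M₁ ≻ F M₂) ×
     (∀ (x y z : PM) → InPM⁺ x → InPM⁺ y → InPM⁺ z →
        ((x ≺ y) ≺ z ≋ x ≺ (y · z)) ×
        ((x ≻ y) ≺ z ≋ x ≻ (y ≺ z)) ×
        ((x · y) ≻ z ≋ x ≻ (y ≻ z))))
proposition2p7 R _ k _ =
  (λ M₁ M₂ nz₁ nz₂ packed₁ packed₂ →
     ≋-split shuffleLabels-flattens precLabels-flattens succLabels-flattens ⧢ᶠ-split
             ((nz₁ , packed₁) ∷ []) ((nz₂ , packed₂) ∷ [])) ,
  (λ x y z px py pz →
       ≋-assoc precLabels-flattens precLabels-flattens shuffleLabels-flattens precLabels-flattens ≺ᶠ-≺ᶠ px py pz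
     , ≋-assoc succLabels-flattens precLabels-flattens precLabels-flattens succLabels-flattens ≻ᶠ-≺ᶠ px py pz
     , ≋-assoc shuffleLabels-flattens succLabels-flattens succLabels-flattens succLabels-flattens ⧢ᶠ-≻ᶠ px py pz)
  where
  open Flat k
  open Transfer R k
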